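{- For every $l\in\mathbb{N}^+$ there is $k\in\mathbb{N}^+$ such that $\mathrm{ar}(T_k)\ge l$, where $T_k:=\mathrm{Th}(\mathfrak{J}(k))$ in the language of graphs.
   Context: $\mathfrak{J}(k)$ is the Johnson graph: vertex set the $k$-element subsets of $\mathbb{N}$, with $x,y$ adjacent iff $|x\cap y|=k-1$. The arity $\mathrm{ar}(T)$ of a complete theory $T$ is the least $m\in\omega$ such that every formula $\phi(x_1,\dots,x_n)$ is equivalent modulo $T$ to a Boolean combination of formulas each involving at most $m$ of the variables, and $\omega$ if no such $m$ exists. -}

module Defs where

open import Data.Nat using (ℕ; zero; suc; _<_; _≤_; _∸_; _≡ᵇ_)
open import Data.Bool using (Bool; true; false; _∨_; if_then_else_)
open import Data.Fin using (Fin)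
open import Data.Vec using (Vec; []; _∷_)
open import Data.Product using (Σ; _×_; proj₁)
open import Data.Unit using (⊤)
open import Data.Empty using (⊥)
open import Relation.Nullary using (¬_)
open import Relation.Binary.PropositionalEquality using (_≡_)
open import Function using (_∘_)

data Formula : ℕ → Set where
  eqF  : ∀ {n} → Fin n → Fin n → Formula n
  adjF : ∀ {n} → Fin n → Fin n → Formula n
  falseF : ∀ {n} → Formula n
  notF : ∀ {n} → Formula n → Formula n
  andF : ∀ {n} → Formula n → Formula n → Formula n
  orF  : ∀ {n} → Formula n → Formula n → Formula n
  impF : ∀ {n} → Formula n → Formula n → Formula n
  exF  : ∀ {n} → Formula (suc n) → Formula n
  allF : ∀ {n} → Formula (suc n) → Formula n

record GraphStr : Set₁ where
  field
    V : Set
    E : V → V → Set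

extend : ∀ {A : Set} {n} → A → (Fin n → A) → Fin (suc n) → A
extend a ρ Fin.zero    = a
extend a ρ (Fin.suc i) = ρ i

-- Classical (Goedel-Gentzen negative translation) satisfaction:
-- every Sat value is ¬¬-stable, so the metatheory behaves classically.
Sat : (M : GraphStr) → ∀ {n} → Formula n → (Fin n → GraphStr.V M) → Set
Sat M (eqF i j)   ρ = ¬ ¬ (ρ i ≡ ρ j)
Sat M (adjF i j)  ρ = ¬ ¬ (GraphStr.E M (ρ i) (ρ j))
Sat M falseF      ρ = ⊥
Sat M (notF φ)    ρ = ¬ Sat M φ ρ
Sat M (andF φ ψ)  ρ = Sat M φ ρ × Sat M ψ ρ
Sat M (orF φ ψ)   ρ = ¬ (¬ Sat M φ ρ × ¬ Sat M ψ ρ)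
Sat M (impF φ ψ)  ρ = Sat M φ ρ → Sat M ψ ρ
Sat M (exF φ)     ρ = ¬ ((a : GraphStr.V M) → ¬ Sat M φ (extend a ρ))
Sat M (allF φ)    ρ = (a : GraphStr.V M) → Sat M φ (extend a ρ)

data BoolComb (A : Set) : Set where
  atom : A → BoolComb A
  bnot : BoolComb A → BoolComb A
  band : BoolComb A → BoolComb A → BoolComb A
  bor  : BoolComb A → BoolComb A → BoolComb A

evalBC : ∀ {A : Set} → (A → Set) → BoolComb A → Set
evalBC v (atom a)   = v a
evalBC v (bnot b)   = ¬ evalBC v b
evalBC v (band b c) = evalBC v b × evalBC v c
evalBC v (bor b c)  = ¬ (¬ evalBC v b × ¬ evalBC v c)

-- A formula in the variables x_1..x_n involving at most m of them:
-- a formula ψ in j ≤ m variables, substituted along σ : Fin j → Fin n.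
record SmallFormula (n m : ℕ) : Set where
  constructor small
  field
    j   : ℕ
    j≤m : j ≤ m
    ψ   : Formula j
    σ   : Fin j → Fin n

satSmall : (M : GraphStr) → ∀ {n m} → (Fin n → GraphStr.V M) → SmallFormula n m → Set
satSmall M ρ (small j _ ψ σ) = Sat M ψ (ρ ∘ σ)

EquivMod : (M : GraphStr) → ∀ {n m} → Formula n → BoolComb (SmallFormula n m) → Set
EquivMod M φ b = ∀ ρ → (Sat M φ ρ → evalBC (satSmall M ρ) b)
                     × (evalBC (satSmall M ρ) b → Sat M φ ρ)

ArityAtMost : GraphStr → ℕ → Set
ArityAtMost M m = ∀ n (φ : Formula n) →
  Σ (BoolComb (SmallFormula n m)) λ b → EquivMod M φ b

-- ar(Th(M)) ≥ l  (ar = least such m, or ω): no m < l works.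
ArityAtLeast : GraphStr → ℕ → Set
ArityAtLeast M l = ∀ m → m < l → ¬ ArityAtMost M m

-- The Johnson graph J(k): vertices are k-subsets of ℕ, represented by
-- their strictly increasing enumeration.

StrictInc : ∀ {k} → Vec ℕ k → Set
StrictInc []               = ⊤
StrictInc (x ∷ [])         = ⊤
StrictInc (x ∷ y ∷ xs)     = x < y × StrictInc (y ∷ xs)

_∈ᵇ_ : ∀ {n} → ℕ → Vec ℕ n → Bool
x ∈ᵇ []       = false
x ∈ᵇ (y ∷ ys) = (x ≡ᵇ y) ∨ (x ∈ᵇ ys)

common : ∀ {n m} → Vec ℕ n → Vec ℕ m → ℕ
common []       w = 0
common (x ∷ xs) w = if x ∈ᵇ w then suc (common xs w) else common xs w

KSubset : ℕ → Set
KSubset k = Σ (Vec ℕ k) StrictInc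

Johnson : ℕ → GraphStr
Johnson k = record
  { V = KSubset k
  ; E = λ x y → common (proj₁ x) (proj₁ y) ≡ k ∸ 1
  }

{-# OPTIONS --safe #-}

-- Put L = l + 3, u = 2^(L-2) - 1 and k = Lu + 1, and read the numbers below T = 2^L as L-bit strings.
-- Let A_i (resp. B_i) consist of the strings with bit i set and with the same (resp. the opposite) parity
-- as 1…1, together with all numbers T + t, t < uL, except the u of them with t ≡ i (mod L).
--
-- Flipping bit i of the strings swaps the two parity classes and fixes every other bit, so it induces an
-- automorphism of J(k) mapping A_j to B_j for all j ≠ i; hence (A_j) and (B_j) satisfy the same formulas
-- in fewer than L variables.  But ∃y ⋀_j d(y, x_j) ≤ u holds of (A_j), witnessed by {1…1} ∪ [T, T + uL),
-- and fails for (B_j): every number lies outside some B_j, so ∑_j |y ∩ B_j| ≤ k(L - 1) < L(k - u) for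
-- every vertex y, while d(y, x) = k - |y ∩ x| in J(k).

module Submission where

open import Defs
open import Data.Nat
open import Data.Nat.Properties
open import Data.Nat.DivMod using (_%_; m<n⇒m%n≡m; [m+kn]%n≡m%n; m%n<n)
open import Data.Bool using (Bool; true; false; _∨_; _∧_; not; if_then_else_; _xor_)
open import Data.Bool.Properties
  using (T-≡; ∨-zeroʳ; ∨-identityʳ; ∨-assoc; ∧-zeroʳ; ∧-identityʳ; not-involutive; not-distribˡ-xor; not-distribʳ-xor;
         xor-inverseʳ; xor-same)
open import Data.Fin using (Fin; zero; suc; toℕ; fromℕ<)
open import Data.Fin.Properties
  using (¬∀⟶∃¬; injective⇒≤; any?; toℕ<n; toℕ-fromℕ<; toℕ-injective) renaming (_≟_ to _≟ᶠ_)
open import Data.Vec using (Vec; []; _∷_; _∷ʳ_; map; sum)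
open import Data.Vec.Relation.Unary.All using (All; []; _∷_) renaming (map to All-map)
open import Data.Unit using (tt)
open import Data.Product using (Σ; ∃; _×_; _,_; proj₁; proj₂)
open import Data.Sum using (_⊎_; inj₁; inj₂)
open import Function using (_∘_; id; _⇔_; mk⇔; Equivalence)
open import Function.Related.TypeIsomorphisms using (¬-cong-⇔; →-cong-⇔)
open import Data.Product.Function.NonDependent.Propositional using (_×-⇔_)
open import Relation.Nullary using (¬_; Dec; yes; no; contradiction)
open import Relation.Binary using (Tri; tri<; tri≈; tri>)
open import Relation.Nullary.Decidable using (dec-true; dec-false)
open import Relation.Binary.PropositionalEquality
open import Algebra.Properties.CommutativeSemigroup +-commutativeSemigroup using (interchange)

≡⇒≡ᵇ≡true : ∀ {m n} → m ≡ n → (m ≡ᵇ n) ≡ true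
≡⇒≡ᵇ≡true {m} {n} = dec-true (m ≟ n)

≢⇒≡ᵇ≡false : ∀ {m n} → m ≢ n → (m ≡ᵇ n) ≡ false
≢⇒≡ᵇ≡false {m} {n} = dec-false (m ≟ n)

≡ᵇ≡true⇒≡ : ∀ {m n} → (m ≡ᵇ n) ≡ true → m ≡ n
≡ᵇ≡true⇒≡ {m} {n} e = ≡ᵇ⇒≡ m n (Equivalence.from T-≡ e)

<⇒<ᵇ≡true : ∀ {m n} → m < n → (m <ᵇ n) ≡ true
<⇒<ᵇ≡true {m} {n} = dec-true (m <? n)

≮⇒<ᵇ≡false : ∀ {m n} → ¬ m < n → (m <ᵇ n) ≡ false
≮⇒<ᵇ≡false {m} {n} = dec-false (m <? n)

𝟙 : Bool → ℕ
𝟙 true  = 1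
𝟙 false = 0

𝟙≤1 : ∀ b → 𝟙 b ≤ 1
𝟙≤1 true  = ≤-refl
𝟙≤1 false = z≤n

-- Finite sums

-- The last summand comes first so that the length of select P (suc N) reduces to 𝟙 (P N) + _.
∑< : ℕ → (ℕ → ℕ) → ℕ
∑< zero    f = 0
∑< (suc N) f = f N + ∑< N f

syntax ∑< N (λ n → e) = ∑[ n < N ] e

∑-cong : ∀ N {f g : ℕ → ℕ} → (∀ n → n < N → f n ≡ g n) → ∑< N f ≡ ∑< N g
∑-cong zero    f≡g = refl
∑-cong (suc N) f≡g = cong₂ _+_ (f≡g N ≤-refl) (∑-cong N (λ n n<N → f≡g n (m≤n⇒m≤1+n n<N)))

∑-mono-≤ : ∀ N {f g : ℕ → ℕ} → (∀ n → n < N → f n ≤ g n) → ∑< N f ≤ ∑< N g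
∑-mono-≤ zero    f≤g = z≤n
∑-mono-≤ (suc N) f≤g = +-mono-≤ (f≤g N ≤-refl) (∑-mono-≤ N (λ n n<N → f≤g n (m≤n⇒m≤1+n n<N)))

∑-distrib-+ : ∀ N (f g : ℕ → ℕ) → ∑[ n < N ] (f n + g n) ≡ ∑< N f + ∑< N g
∑-distrib-+ zero    f g = refl
∑-distrib-+ (suc N) f g =
  trans (cong (f N + g N +_) (∑-distrib-+ N f g)) (interchange (f N) (g N) (∑< N f) (∑< N g))

∑-const : ∀ N c → ∑[ _ < N ] c ≡ N * c
∑-const zero    c = refl
∑-const (suc N) c = cong (c +_) (∑-const N c)

∑-*ˡ : ∀ N c (f : ℕ → ℕ) → ∑[ n < N ] (c * f n) ≡ c * ∑< N f
∑-*ˡ zero    c f = sym (*-zeroʳ c)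
∑-*ˡ (suc N) c f = trans (cong (c * f N +_) (∑-*ˡ N c f)) (sym (*-distribˡ-+ c (f N) (∑< N f)))

∑-+ : ∀ b a (f : ℕ → ℕ) → ∑< (b + a) f ≡ ∑[ t < b ] f (t + a) + ∑< a f
∑-+ zero    a f = refl
∑-+ (suc b) a f = trans (cong (f (b + a) +_) (∑-+ b a f)) (sym (+-assoc (f (b + a)) _ _))

∑-mod : ∀ L .{{_ : NonZero L}} u (g : ℕ → ℕ) → ∑[ n < u * L ] g (n % L) ≡ u * ∑< L g
∑-mod L zero    g = refl
∑-mod L (suc u) g = begin
  ∑[ n < L + u * L ] g (n % L)                       ≡⟨ ∑-+ L (u * L) _ ⟩
  ∑[ t < L ] g ((t + u * L) % L) + ∑[ n < u * L ] g (n % L)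
    ≡⟨ cong₂ _+_ (∑-cong L (λ t t<L → cong g (trans ([m+kn]%n≡m%n t u L) (m<n⇒m%n≡m t<L))))
                 (∑-mod L u g) ⟩
  ∑< L g + u * ∑< L g                                ∎
  where open ≡-Reasoning

∑-delta : ∀ a N (f : ℕ → ℕ) → a < N → ∑[ n < N ] (𝟙 (n ≡ᵇ a) * f n) ≡ f a
∑-delta a (suc N) f a<1+N with N ≟ a
... | yes refl rewrite ≡⇒≡ᵇ≡true {a} refl =
  trans (cong (f a + 0 +_) (∑-zero a ≤-refl)) (trans (+-identityʳ _) (+-identityʳ (f a)))
  where
  ∑-zero : ∀ M → M ≤ a → ∑[ n < M ] (𝟙 (n ≡ᵇ a) * f n) ≡ 0
  ∑-zero zero    _   = refl
  ∑-zero (suc M) M<a rewrite ≢⇒≡ᵇ≡false (<⇒≢ M<a) = ∑-zero M (<⇒≤ M<a)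
... | no N≢a rewrite ≢⇒≡ᵇ≡false N≢a = ∑-delta a N f (≤∧≢⇒< (≤-pred a<1+N) (N≢a ∘ sym))

∑ᶠ : ∀ {m} → (Fin m → ℕ) → ℕ
∑ᶠ {zero}  f = 0
∑ᶠ {suc m} f = f zero + ∑ᶠ (f ∘ suc)

∑ᶠ-cong : ∀ {m} {f g : Fin m → ℕ} → (∀ i → f i ≡ g i) → ∑ᶠ f ≡ ∑ᶠ g
∑ᶠ-cong {zero}  f≡g = refl
∑ᶠ-cong {suc m} f≡g = cong₂ _+_ (f≡g zero) (∑ᶠ-cong (f≡g ∘ suc))

∑ᶠ-mono-≤ : ∀ {m} {f g : Fin m → ℕ} → (∀ i → f i ≤ g i) → ∑ᶠ f ≤ ∑ᶠ g
∑ᶠ-mono-≤ {zero}  f≤g = z≤n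
∑ᶠ-mono-≤ {suc m} f≤g = +-mono-≤ (f≤g zero) (∑ᶠ-mono-≤ (f≤g ∘ suc))

∑ᶠ-distrib-+ : ∀ {m} (f g : Fin m → ℕ) → ∑ᶠ (λ i → f i + g i) ≡ ∑ᶠ f + ∑ᶠ g
∑ᶠ-distrib-+ {zero}  f g = refl
∑ᶠ-distrib-+ {suc m} f g =
  trans (cong (f zero + g zero +_) (∑ᶠ-distrib-+ (f ∘ suc) (g ∘ suc)))
        (interchange (f zero) (g zero) (∑ᶠ (f ∘ suc)) (∑ᶠ (g ∘ suc)))

∑ᶠ-const : ∀ m c → ∑ᶠ {m} (λ _ → c) ≡ m * c
∑ᶠ-const zero    c = refl
∑ᶠ-const (suc m) c = cong (c +_) (∑ᶠ-const m c)

∑ᶠ-*ˡ : ∀ {m} c (f : Fin m → ℕ) → ∑ᶠ (λ i → c * f i) ≡ c * ∑ᶠ f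
∑ᶠ-*ˡ {zero}  c f = sym (*-zeroʳ c)
∑ᶠ-*ˡ {suc m} c f = trans (cong (c * f zero +_) (∑ᶠ-*ˡ c (f ∘ suc))) (sym (*-distribˡ-+ c (f zero) _))

∑ᶠ-∑-comm : ∀ {m} N (f : Fin m → ℕ → ℕ) →
            ∑ᶠ (λ i → ∑[ n < N ] f i n) ≡ ∑[ n < N ] ∑ᶠ (λ i → f i n)
∑ᶠ-∑-comm {m} zero    f = trans (∑ᶠ-const m 0) (*-zeroʳ m)
∑ᶠ-∑-comm     (suc N) f =
  trans (∑ᶠ-distrib-+ (λ i → f i N) (λ i → ∑< N (f i))) (cong (∑ᶠ (λ i → f i N) +_) (∑ᶠ-∑-comm N f))

∑ᶠ-𝟙-≤ : ∀ m (b : Fin (suc m) → Bool) → ∃ (λ j → b j ≡ false) → ∑ᶠ (𝟙 ∘ b) ≤ m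
∑ᶠ-𝟙-≤ m       b (zero , b₀≡false) rewrite b₀≡false =
  ≤-trans (∑ᶠ-mono-≤ (𝟙≤1 ∘ b ∘ suc)) (≤-reflexive (trans (∑ᶠ-const m 1) (*-identityʳ m)))
∑ᶠ-𝟙-≤ (suc m) b (suc j , bⱼ≡false) =
  +-mono-≤ (𝟙≤1 (b zero)) (∑ᶠ-𝟙-≤ m (b ∘ suc) (j , bⱼ≡false))

StrictInc-tail : ∀ {m} x (xs : Vec ℕ m) → StrictInc (x ∷ xs) → StrictInc xs
StrictInc-tail x []       _       = tt
StrictInc-tail x (y ∷ ys) (_ , s) = s

StrictInc-head : ∀ {m} x (xs : Vec ℕ m) → StrictInc (x ∷ xs) → All (x <_) xs
StrictInc-head x []       _         = []
StrictInc-head x (y ∷ ys) (x<y , s) = x<y ∷ All-map (<-trans x<y) (StrictInc-head y ys s)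

StrictInc-irrelevant : ∀ {m} (v : Vec ℕ m) (p q : StrictInc v) → p ≡ q
StrictInc-irrelevant []          tt       tt       = refl
StrictInc-irrelevant (x ∷ [])    tt       tt       = refl
StrictInc-irrelevant (x ∷ y ∷ v) (p , p′) (q , q′) =
  cong₂ _,_ (<-irrelevant p q) (StrictInc-irrelevant (y ∷ v) p′ q′)

StrictInc-∷ʳ : ∀ {m x} (xs : Vec ℕ m) → All (_< x) xs → StrictInc xs → StrictInc (xs ∷ʳ x)
StrictInc-∷ʳ []           _            _         = tt
StrictInc-∷ʳ (y ∷ [])     (y<x ∷ [])   _         = y<x , tt
StrictInc-∷ʳ (y ∷ z ∷ zs) (_ ∷ z∷zs<x) (y<z , s) = y<z , StrictInc-∷ʳ (z ∷ zs) z∷zs<x s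

All-∷ʳ : ∀ {m} {P : ℕ → Set} {x} (xs : Vec ℕ m) → All P xs → P x → All P (xs ∷ʳ x)
All-∷ʳ []       []         px = px ∷ []
All-∷ʳ (y ∷ ys) (py ∷ pys) px = py ∷ All-∷ʳ ys pys px

∈ᵇ-All : ∀ {m} {P : ℕ → Set} n (v : Vec ℕ m) → All P v → (n ∈ᵇ v) ≡ true → P n
∈ᵇ-All {P = P} n (x ∷ xs) (px ∷ pxs) n∈ with n ≡ᵇ x in n≡ᵇx
... | true  = subst P (sym (≡ᵇ≡true⇒≡ {n} {x} n≡ᵇx)) px
... | false = ∈ᵇ-All n xs pxs n∈

All->-∉ᵇ : ∀ {m a} (xs : Vec ℕ m) → All (a <_) xs → (a ∈ᵇ xs) ≡ false
All->-∉ᵇ {a = a} xs a<xs with a ∈ᵇ xs in a∈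
... | true  = contradiction (∈ᵇ-All a xs a<xs a∈) (<-irrefl refl)
... | false = refl

∈ᵇ-∷ʳ : ∀ {m} n (xs : Vec ℕ m) x → (n ∈ᵇ (xs ∷ʳ x)) ≡ (n ∈ᵇ xs) ∨ (n ≡ᵇ x)
∈ᵇ-∷ʳ n []       x = ∨-identityʳ (n ≡ᵇ x)
∈ᵇ-∷ʳ n (y ∷ ys) x = trans (cong ((n ≡ᵇ y) ∨_) (∈ᵇ-∷ʳ n ys x)) (sym (∨-assoc (n ≡ᵇ y) _ _))

All-<-suc-sum : ∀ {m} (v : Vec ℕ m) → All (_< suc (sum v)) v
All-<-suc-sum []       = []
All-<-suc-sum (x ∷ xs) =
  s≤s (m≤m+n x (sum xs)) ∷ All-map (λ y<s → <-≤-trans y<s (s≤s (m≤n+m _ x))) (All-<-suc-sum xs)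

𝟙-∨-disjoint : ∀ a b → (a ≡ true → b ≡ false) → 𝟙 (a ∨ b) ≡ 𝟙 a + 𝟙 b
𝟙-∨-disjoint true  b a⇒¬b rewrite a⇒¬b refl = refl
𝟙-∨-disjoint false b _    = refl

∑-∈ᵇ : ∀ {m N} (v : Vec ℕ m) → StrictInc v → All (_< N) v → ∀ f →
       ∑[ n < N ] (𝟙 (n ∈ᵇ v) * f n) ≡ sum (map f v)
∑-∈ᵇ {N = N} []       _ _ f = trans (∑-const N 0) (*-zeroʳ N)
∑-∈ᵇ {N = N} (x ∷ xs) s (x<N ∷ xs<N) f = begin
  ∑[ n < N ] (𝟙 ((n ≡ᵇ x) ∨ (n ∈ᵇ xs)) * f n)
    ≡⟨ ∑-cong N (λ n _ → trans (cong (_* f n) (𝟙-∨-disjoint _ _ (x∉xs n)))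
                               (*-distribʳ-+ (f n) (𝟙 (n ≡ᵇ x)) _)) ⟩
  ∑[ n < N ] (𝟙 (n ≡ᵇ x) * f n + 𝟙 (n ∈ᵇ xs) * f n)
    ≡⟨ ∑-distrib-+ N _ _ ⟩
  ∑[ n < N ] (𝟙 (n ≡ᵇ x) * f n) + ∑[ n < N ] (𝟙 (n ∈ᵇ xs) * f n)
    ≡⟨ cong₂ _+_ (∑-delta x N f x<N) (∑-∈ᵇ xs (StrictInc-tail x xs s) xs<N f) ⟩
  f x + sum (map f xs) ∎
  where
  open ≡-Reasoning
  x∉xs : ∀ n → (n ≡ᵇ x) ≡ true → (n ∈ᵇ xs) ≡ false
  x∉xs n n≡ᵇx rewrite ≡ᵇ≡true⇒≡ {n} n≡ᵇx = All->-∉ᵇ xs (StrictInc-head x xs s)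

snocIf : ∀ {m} (b : Bool) → Vec ℕ m → ℕ → Vec ℕ (𝟙 b + m)
snocIf true  xs x = xs ∷ʳ x
snocIf false xs x = xs

select : (P : ℕ → Bool) (N : ℕ) → Vec ℕ (∑[ n < N ] 𝟙 (P n))
select P zero    = []
select P (suc N) = snocIf (P N) (select P N) N

select-All : ∀ P N → All (_< N) (select P N)
select-All P zero    = []
select-All P (suc N) with P N
... | true  = All-∷ʳ (select P N) (All-map (m≤n⇒m≤1+n) (select-All P N)) ≤-refl
... | false = All-map (m≤n⇒m≤1+n) (select-All P N)

select-StrictInc : ∀ P N → StrictInc (select P N)
select-StrictInc P zero    = tt
select-StrictInc P (suc N) with P N
... | true  = StrictInc-∷ʳ (select P N) (select-All P N) (select-StrictInc P N)
... | false = select-StrictInc P N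

∈ᵇ-select : ∀ P N n → (n ∈ᵇ select P N) ≡ (n <ᵇ N) ∧ P n
∈ᵇ-select P zero    n = refl
∈ᵇ-select P (suc N) n = trans (∈ᵇ-snocIf (P N)) (step (<-cmp n N))
  where
  ∈ᵇ-snocIf : ∀ b → (n ∈ᵇ snocIf b (select P N) N) ≡ ((n <ᵇ N) ∧ P n) ∨ (b ∧ (n ≡ᵇ N))
  ∈ᵇ-snocIf true  = trans (∈ᵇ-∷ʳ n (select P N) N) (cong (_∨ (n ≡ᵇ N)) (∈ᵇ-select P N n))
  ∈ᵇ-snocIf false = trans (∈ᵇ-select P N n) (sym (∨-identityʳ _))
  step : Tri (n < N) (n ≡ N) (N < n) → ((n <ᵇ N) ∧ P n) ∨ (P N ∧ (n ≡ᵇ N)) ≡ (n <ᵇ suc N) ∧ P n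
  step (tri< n<N n≢N _)
    rewrite <⇒<ᵇ≡true n<N | ≢⇒≡ᵇ≡false n≢N | ∧-zeroʳ (P N) | <⇒<ᵇ≡true (m≤n⇒m≤1+n n<N) = ∨-identityʳ (P n)
  step (tri≈ n≮N refl _)
    rewrite ≮⇒<ᵇ≡false n≮N | ≡⇒≡ᵇ≡true {n} refl | <⇒<ᵇ≡true (n<1+n n) = ∧-identityʳ (P n)
  step (tri> n≮N n≢N N<n)
    rewrite ≮⇒<ᵇ≡false n≮N | ≢⇒≡ᵇ≡false n≢N | ∧-zeroʳ (P N) | ≮⇒<ᵇ≡false (<⇒≱ N<n ∘ ≤-pred) = refl

∈ᵇ-head : ∀ {m} x (xs : Vec ℕ m) → (x ∈ᵇ (x ∷ xs)) ≡ true
∈ᵇ-head x xs = cong (_∨ (x ∈ᵇ xs)) (≡⇒≡ᵇ≡true {x} refl)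

<-head-∉ᵇ : ∀ {m x y} (ys : Vec ℕ m) → StrictInc (y ∷ ys) → x < y → (x ∈ᵇ (y ∷ ys)) ≡ false
<-head-∉ᵇ {y = y} ys s x<y = All->-∉ᵇ (y ∷ ys) (x<y ∷ All-map (<-trans x<y) (StrictInc-head y ys s))

StrictInc-ext : ∀ {m} (v w : Vec ℕ m) → StrictInc v → StrictInc w →
                (∀ n → (n ∈ᵇ v) ≡ (n ∈ᵇ w)) → v ≡ w
StrictInc-ext []       []       _  _  _    = refl
StrictInc-ext (x ∷ xs) (y ∷ ys) sv sw same with heads (<-cmp x y)
  where
  heads : Tri (x < y) (x ≡ y) (y < x) → x ≡ y
  heads (tri< x<y _ _) = contradiction (trans (sym (∈ᵇ-head x xs)) (trans (same x) (<-head-∉ᵇ ys sw x<y))) λ ()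
  heads (tri≈ _ x≡y _) = x≡y
  heads (tri> _ _ y<x) =
    contradiction (trans (sym (∈ᵇ-head y ys)) (trans (sym (same y)) (<-head-∉ᵇ xs sv y<x))) λ ()
... | refl = cong (x ∷_) (StrictInc-ext xs ys (StrictInc-tail x xs sv) (StrictInc-tail x ys sw) tails)
  where
  tails : ∀ n → (n ∈ᵇ xs) ≡ (n ∈ᵇ ys)
  tails n with n ≟ x
  ... | yes refl = trans (All->-∉ᵇ xs (StrictInc-head x xs sv)) (sym (All->-∉ᵇ ys (StrictInc-head x ys sw)))
  ... | no  n≢x  = subst (λ b → b ∨ (n ∈ᵇ xs) ≡ b ∨ (n ∈ᵇ ys)) (≢⇒≡ᵇ≡false n≢x) (same n)

-- k-element subsets of ℕ

_∋_ : ∀ {k} → KSubset k → ℕ → Bool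
v ∋ n = n ∈ᵇ proj₁ v

∣_∩_∣ : ∀ {k} → KSubset k → KSubset k → ℕ
∣ v ∩ w ∣ = common (proj₁ v) (proj₁ w)

KSubset-ext : ∀ {k} (v w : KSubset k) → (∀ n → v ∋ n ≡ w ∋ n) → v ≡ w
KSubset-ext (v , p) (w , q) same with StrictInc-ext v w p q same
... | refl = cong (v ,_) (StrictInc-irrelevant v p q)

BoundedBy : ∀ {k} → KSubset k → ℕ → Set
BoundedBy v N = All (_< N) (proj₁ v)

bound : ∀ {k} → KSubset k → ℕ
bound v = suc (sum (proj₁ v))

boundedBy-bound : ∀ {k} (v : KSubset k) → BoundedBy v (bound v)
boundedBy-bound v = All-<-suc-sum (proj₁ v)

boundedBy-mono : ∀ {k N M} (v : KSubset k) → N ≤ M → BoundedBy v N → BoundedBy v M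
boundedBy-mono v N≤M = All-map (λ n<N → <-≤-trans n<N N≤M)

boundedBy-∌ : ∀ {k N} (v : KSubset k) n → BoundedBy v N → N ≤ n → v ∋ n ≡ false
boundedBy-∌ v n v<N N≤n with v ∋ n in v∋n
... | true  = contradiction (∈ᵇ-All n (proj₁ v) v<N v∋n) (≤⇒≯ N≤n)
... | false = refl

∑-∋ : ∀ {k N} (v : KSubset k) → BoundedBy v N → ∀ f →
      ∑[ n < N ] (𝟙 (v ∋ n) * f n) ≡ sum (map f (proj₁ v))
∑-∋ (v , s) = ∑-∈ᵇ v s

size-∑ : ∀ {k N} (v : KSubset k) → BoundedBy v N → ∑[ n < N ] 𝟙 (v ∋ n) ≡ k
size-∑ {N = N} v v<N =
  trans (∑-cong N (λ n _ → sym (*-identityʳ _))) (trans (∑-∋ v v<N (λ _ → 1)) (sum-ones (proj₁ v)))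
  where
  sum-ones : ∀ {m} (xs : Vec ℕ m) → sum (map (λ _ → 1) xs) ≡ m
  sum-ones []       = refl
  sum-ones (x ∷ xs) = cong suc (sum-ones xs)

∣∩∣-∑ : ∀ {k N} (v w : KSubset k) → BoundedBy v N →
        ∣ v ∩ w ∣ ≡ ∑[ n < N ] (𝟙 (v ∋ n) * 𝟙 (w ∋ n))
∣∩∣-∑ v w v<N = trans (common-sum (proj₁ v)) (sym (∑-∋ v v<N (λ n → 𝟙 (w ∋ n))))
  where
  common-sum : ∀ {m} (xs : Vec ℕ m) → common xs (proj₁ w) ≡ sum (map (λ n → 𝟙 (w ∋ n)) xs)
  common-sum []       = refl
  common-sum (x ∷ xs) with w ∋ x
  ... | true  = cong suc (common-sum xs)
  ... | false = common-sum xs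

∣∩∣-comm : ∀ {k} (v w : KSubset k) → ∣ v ∩ w ∣ ≡ ∣ w ∩ v ∣
∣∩∣-comm v w = begin
  ∣ v ∩ w ∣                           ≡⟨ ∣∩∣-∑ v w (boundedBy-mono v (m≤m+n (bound v) (bound w)) (boundedBy-bound v)) ⟩
  ∑[ n < N ] (𝟙 (v ∋ n) * 𝟙 (w ∋ n))  ≡⟨ ∑-cong N (λ n _ → *-comm (𝟙 (v ∋ n)) _) ⟩
  ∑[ n < N ] (𝟙 (w ∋ n) * 𝟙 (v ∋ n))  ≡⟨ ∣∩∣-∑ w v (boundedBy-mono w (m≤n+m (bound w) (bound v)) (boundedBy-bound w)) ⟨
  ∣ w ∩ v ∣                           ∎
  where
  open ≡-Reasoning
  N = bound v + bound w

∣∩∣-self : ∀ {k} (v : KSubset k) → ∣ v ∩ v ∣ ≡ k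
∣∩∣-self v = trans (∣∩∣-∑ v v (boundedBy-bound v))
                   (trans (∑-cong (bound v) (λ n _ → 𝟙-idem (v ∋ n))) (size-∑ v (boundedBy-bound v)))
  where
  𝟙-idem : ∀ b → 𝟙 b * 𝟙 b ≡ 𝟙 b
  𝟙-idem true  = refl
  𝟙-idem false = refl

∃-∈-∉ : ∀ {k} (v w : KSubset k) → ∣ v ∩ w ∣ < k → ∃ λ a → v ∋ a ≡ true × w ∋ a ≡ false
∃-∈-∉ v w = go (proj₁ v)
  where
  go : ∀ {m} (xs : Vec ℕ m) → common xs (proj₁ w) < m → ∃ λ a → (a ∈ᵇ xs) ≡ true × w ∋ a ≡ false
  go (x ∷ xs) c<m with w ∋ x in w∋x
  ... | true  = let (a , a∈xs , w∌a) = go xs (≤-pred c<m) in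
                a , trans (cong ((a ≡ᵇ x) ∨_) a∈xs) (∨-zeroʳ _) , w∌a
  ... | false = x , ∈ᵇ-head x xs , w∋x

∣∩∣-+-∣∩∣-≤ : ∀ {k} (z x y : KSubset k) → ∣ z ∩ x ∣ + ∣ z ∩ y ∣ ≤ ∣ y ∩ x ∣ + k
∣∩∣-+-∣∩∣-≤ {k} z x y = begin
  ∣ z ∩ x ∣ + ∣ z ∩ y ∣
    ≡⟨ cong₂ _+_ (∣∩∣-∑ z x z<N) (∣∩∣-∑ z y z<N) ⟩
  ∑[ n < N ] (𝟙 (z ∋ n) * 𝟙 (x ∋ n)) + ∑[ n < N ] (𝟙 (z ∋ n) * 𝟙 (y ∋ n))
    ≡⟨ ∑-distrib-+ N (λ n → 𝟙 (z ∋ n) * 𝟙 (x ∋ n)) _ ⟨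
  ∑[ n < N ] (𝟙 (z ∋ n) * 𝟙 (x ∋ n) + 𝟙 (z ∋ n) * 𝟙 (y ∋ n))
    ≤⟨ ∑-mono-≤ N (λ n _ → pointwise (z ∋ n) (x ∋ n) (y ∋ n)) ⟩
  ∑[ n < N ] (𝟙 (y ∋ n) * 𝟙 (x ∋ n) + 𝟙 (z ∋ n))
    ≡⟨ ∑-distrib-+ N (λ n → 𝟙 (y ∋ n) * 𝟙 (x ∋ n)) _ ⟩
  ∑[ n < N ] (𝟙 (y ∋ n) * 𝟙 (x ∋ n)) + ∑[ n < N ] 𝟙 (z ∋ n)
    ≡⟨ cong₂ _+_ (sym (∣∩∣-∑ y x y<N)) (size-∑ z z<N) ⟩
  ∣ y ∩ x ∣ + k
    ∎
  where
  open ≤-Reasoning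
  N = bound y + bound z
  y<N = boundedBy-mono y (m≤m+n (bound y) (bound z)) (boundedBy-bound y)
  z<N = boundedBy-mono z (m≤n+m (bound z) (bound y)) (boundedBy-bound z)
  pointwise : ∀ bz bx by → 𝟙 bz * 𝟙 bx + 𝟙 bz * 𝟙 by ≤ 𝟙 by * 𝟙 bx + 𝟙 bz
  pointwise false bx    by    = z≤n
  pointwise true  true  true  = ≤-refl
  pointwise true  true  false = ≤-refl
  pointwise true  false true  = ≤-refl
  pointwise true  false false = z≤n

fromPredicate : ∀ {k} (P : ℕ → Bool) N → ∑[ n < N ] 𝟙 (P n) ≡ k → KSubset k
fromPredicate P N refl = select P N , select-StrictInc P N

∋-fromPredicate : ∀ {k} P N (size : ∑[ n < N ] 𝟙 (P n) ≡ k) n →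
                  fromPredicate P N size ∋ n ≡ (n <ᵇ N) ∧ P n
∋-fromPredicate P N refl n = ∈ᵇ-select P N n

boundedBy-fromPredicate : ∀ {k} P N (size : ∑[ n < N ] 𝟙 (P n) ≡ k) → BoundedBy (fromPredicate P N size) N
boundedBy-fromPredicate P N refl = select-All P N

∣∩∣-fromPredicate : ∀ {k} P N (size : ∑[ n < N ] 𝟙 (P n) ≡ k) (w : KSubset k) →
                    ∣ fromPredicate P N size ∩ w ∣ ≡ ∑[ n < N ] (𝟙 (P n) * 𝟙 (w ∋ n))
∣∩∣-fromPredicate P N size w =
  trans (∣∩∣-∑ (fromPredicate P N size) w (boundedBy-fromPredicate P N size))
        (∑-cong N (λ n n<N → cong (λ b → 𝟙 b * 𝟙 (w ∋ n))
                                  (trans (∋-fromPredicate P N size n) (cong (_∧ P n) (<⇒<ᵇ≡true n<N)))))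

∣∩∣-fromPredicate² : ∀ {k} P Q N (sizeP : ∑[ n < N ] 𝟙 (P n) ≡ k) (sizeQ : ∑[ n < N ] 𝟙 (Q n) ≡ k) →
                     ∣ fromPredicate P N sizeP ∩ fromPredicate Q N sizeQ ∣ ≡ ∑[ n < N ] (𝟙 (P n) * 𝟙 (Q n))
∣∩∣-fromPredicate² P Q N sizeP sizeQ =
  trans (∣∩∣-fromPredicate P N sizeP (fromPredicate Q N sizeQ))
        (∑-cong N (λ n n<N → cong (λ b → 𝟙 (P n) * 𝟙 b)
                                  (trans (∋-fromPredicate Q N sizeQ n) (cong (_∧ Q n) (<⇒<ᵇ≡true n<N)))))

module Replace {k} (y : KSubset k) (a b : ℕ) (y∋a : y ∋ a ≡ true) (y∌b : y ∋ b ≡ false) where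

  P : ℕ → Bool
  P n = (y ∋ n ∧ not (n ≡ᵇ a)) ∨ (n ≡ᵇ b)

  N : ℕ
  N = suc b + bound y

  y<N : BoundedBy y N
  y<N = boundedBy-mono y (m≤n+m (bound y) (suc b)) (boundedBy-bound y)

  𝟙-P : ∀ n → 𝟙 (P n) + 𝟙 (n ≡ᵇ a) ≡ 𝟙 (y ∋ n) + 𝟙 (n ≡ᵇ b)
  𝟙-P n = 𝟙-swap (y ∋ n) (n ≡ᵇ a) (n ≡ᵇ b)
    (λ e → subst (λ t → y ∋ t ≡ true) (sym (≡ᵇ≡true⇒≡ {n} e)) y∋a)
    (λ e → subst (λ t → y ∋ t ≡ false) (sym (≡ᵇ≡true⇒≡ {n} e)) y∌b)
    where
    𝟙-swap : ∀ m ea eb → (ea ≡ true → m ≡ true) → (eb ≡ true → m ≡ false) →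
             𝟙 ((m ∧ not ea) ∨ eb) + 𝟙 ea ≡ 𝟙 m + 𝟙 eb
    𝟙-swap true  true  true  _    eb⇒¬m = contradiction (eb⇒¬m refl) λ ()
    𝟙-swap true  true  false _    _     = refl
    𝟙-swap true  false true  _    eb⇒¬m = contradiction (eb⇒¬m refl) λ ()
    𝟙-swap true  false false _    _     = refl
    𝟙-swap false true  eb    ea⇒m _     = contradiction (ea⇒m refl) λ ()
    𝟙-swap false false true  _    _     = refl
    𝟙-swap false false false _    _     = refl

  ∑-P : ∀ h → ∑[ n < N ] (𝟙 (P n) * h n) + h a ≡ ∑[ n < N ] (𝟙 (y ∋ n) * h n) + h b
  ∑-P h = begin
    ∑[ n < N ] (𝟙 (P n) * h n) + h a
      ≡⟨ cong (∑[ n < N ] (𝟙 (P n) * h n) +_) (∑-delta a N h (∈ᵇ-All a (proj₁ y) y<N y∋a)) ⟨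
    ∑[ n < N ] (𝟙 (P n) * h n) + ∑[ n < N ] (𝟙 (n ≡ᵇ a) * h n)
      ≡⟨ ∑-distrib-+ N (λ n → 𝟙 (P n) * h n) _ ⟨
    ∑[ n < N ] (𝟙 (P n) * h n + 𝟙 (n ≡ᵇ a) * h n)
      ≡⟨ ∑-cong N (λ n _ → begin
           𝟙 (P n) * h n + 𝟙 (n ≡ᵇ a) * h n     ≡⟨ *-distribʳ-+ (h n) (𝟙 (P n)) _ ⟨
           (𝟙 (P n) + 𝟙 (n ≡ᵇ a)) * h n        ≡⟨ cong (_* h n) (𝟙-P n) ⟩
           (𝟙 (y ∋ n) + 𝟙 (n ≡ᵇ b)) * h n      ≡⟨ *-distribʳ-+ (h n) (𝟙 (y ∋ n)) _ ⟩
           𝟙 (y ∋ n) * h n + 𝟙 (n ≡ᵇ b) * h n  ∎) ⟩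
    ∑[ n < N ] (𝟙 (y ∋ n) * h n + 𝟙 (n ≡ᵇ b) * h n)
      ≡⟨ ∑-distrib-+ N (λ n → 𝟙 (y ∋ n) * h n) _ ⟩
    ∑[ n < N ] (𝟙 (y ∋ n) * h n) + ∑[ n < N ] (𝟙 (n ≡ᵇ b) * h n)
      ≡⟨ cong (∑[ n < N ] (𝟙 (y ∋ n) * h n) +_) (∑-delta b N h (m≤m+n (suc b) (bound y))) ⟩
    ∑[ n < N ] (𝟙 (y ∋ n) * h n) + h b
      ∎
    where open ≡-Reasoning

  size : ∑[ n < N ] 𝟙 (P n) ≡ k
  size = +-cancelʳ-≡ 1 _ _ (begin
    ∑[ n < N ] 𝟙 (P n) + 1          ≡⟨ cong (_+ 1) (∑-cong N (λ n _ → *-identityʳ _)) ⟨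
    ∑[ n < N ] (𝟙 (P n) * 1) + 1    ≡⟨ ∑-P (λ _ → 1) ⟩
    ∑[ n < N ] (𝟙 (y ∋ n) * 1) + 1  ≡⟨ cong (_+ 1) (trans (∑-cong N (λ n _ → *-identityʳ _)) (size-∑ y y<N)) ⟩
    k + 1                           ∎)
    where open ≡-Reasoning

  replaced : KSubset k
  replaced = fromPredicate P N size

  ∣replaced∩∣ : ∀ w → ∣ replaced ∩ w ∣ + 𝟙 (w ∋ a) ≡ ∣ y ∩ w ∣ + 𝟙 (w ∋ b)
  ∣replaced∩∣ w = begin
    ∣ replaced ∩ w ∣ + 𝟙 (w ∋ a)                    ≡⟨ cong (_+ 𝟙 (w ∋ a)) (∣∩∣-fromPredicate P N size w) ⟩
    ∑[ n < N ] (𝟙 (P n) * 𝟙 (w ∋ n)) + 𝟙 (w ∋ a)    ≡⟨ ∑-P (λ n → 𝟙 (w ∋ n)) ⟩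
    ∑[ n < N ] (𝟙 (y ∋ n) * 𝟙 (w ∋ n)) + 𝟙 (w ∋ b)  ≡⟨ cong (_+ 𝟙 (w ∋ b)) (∣∩∣-∑ y w y<N) ⟨
    ∣ y ∩ w ∣ + 𝟙 (w ∋ b)                           ∎
    where open ≡-Reasoning

∑ᶠ-∣∩∣-≤ : ∀ {k m} (y : KSubset k) (B : Fin (suc m) → KSubset k) → (∀ n → ∃ λ j → B j ∋ n ≡ false) →
           ∑ᶠ (λ j → ∣ y ∩ B j ∣) ≤ k * m
∑ᶠ-∣∩∣-≤ {k} {m} y B uncovered = begin
  ∑ᶠ (λ j → ∣ y ∩ B j ∣)                           ≡⟨ ∑ᶠ-cong (λ j → ∣∩∣-∑ y (B j) y<N) ⟩
  ∑ᶠ (λ j → ∑[ n < N ] (𝟙 (y ∋ n) * 𝟙 (B j ∋ n)))  ≡⟨ ∑ᶠ-∑-comm N (λ j n → 𝟙 (y ∋ n) * 𝟙 (B j ∋ n)) ⟩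
  ∑[ n < N ] ∑ᶠ (λ j → 𝟙 (y ∋ n) * 𝟙 (B j ∋ n))    ≡⟨ ∑-cong N (λ n _ → ∑ᶠ-*ˡ (𝟙 (y ∋ n)) (λ j → 𝟙 (B j ∋ n))) ⟩
  ∑[ n < N ] (𝟙 (y ∋ n) * ∑ᶠ (λ j → 𝟙 (B j ∋ n)))
    ≤⟨ ∑-mono-≤ N (λ n _ → *-monoʳ-≤ (𝟙 (y ∋ n)) (∑ᶠ-𝟙-≤ m (λ j → B j ∋ n) (uncovered n))) ⟩
  ∑[ n < N ] (𝟙 (y ∋ n) * m)                       ≡⟨ ∑-cong N (λ n _ → *-comm (𝟙 (y ∋ n)) m) ⟩
  ∑[ n < N ] (m * 𝟙 (y ∋ n))                       ≡⟨ ∑-*ˡ N m _ ⟩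
  m * ∑[ n < N ] 𝟙 (y ∋ n)                         ≡⟨ cong (m *_) (size-∑ y y<N) ⟩
  m * k                                            ≡⟨ *-comm m k ⟩
  k * m                                            ∎
  where
  open ≤-Reasoning
  N = bound y
  y<N = boundedBy-bound y

no-vertex-near-all : ∀ {k m} u (B : Fin (suc m) → KSubset k) → (∀ n → ∃ λ j → B j ∋ n ≡ false) →
                     suc m * u < k → ∀ y → ¬ (∀ j → k ≤ ∣ y ∩ B j ∣ + u)
no-vertex-near-all {k} {m} u B uncovered mu<k y near = <-irrefl refl (begin-strict
  suc m * k                                        ≡⟨ ∑ᶠ-const (suc m) k ⟨
  ∑ᶠ {suc m} (λ _ → k)                             ≤⟨ ∑ᶠ-mono-≤ near ⟩
  ∑ᶠ (λ j → ∣ y ∩ B j ∣ + u)                       ≡⟨ ∑ᶠ-distrib-+ (λ j → ∣ y ∩ B j ∣) (λ _ → u) ⟩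
  ∑ᶠ (λ j → ∣ y ∩ B j ∣) + ∑ᶠ {suc m} (λ _ → u)
    ≤⟨ +-mono-≤ (∑ᶠ-∣∩∣-≤ y B uncovered) (≤-reflexive (∑ᶠ-const (suc m) u)) ⟩
  k * m + suc m * u                                <⟨ +-monoʳ-< (k * m) mu<k ⟩
  k * m + k                                        ≡⟨ +-comm (k * m) k ⟩
  k + k * m                                        ≡⟨ *-suc k m ⟨
  k * suc m                                        ≡⟨ *-comm k (suc m) ⟩
  suc m * k                                        ∎)
  where open ≤-Reasoning

-- First-order logic

record Automorphism (M : GraphStr) : Set where
  open GraphStr M
  field
    act       : V → V
    act⁻¹     : V → V
    act⁻¹∘act : ∀ v → act⁻¹ (act v) ≡ v
    act∘act⁻¹ : ∀ v → act (act⁻¹ v) ≡ v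
    act-E     : ∀ {v w} → E v w → E (act v) (act w)
    act⁻¹-E   : ∀ {v w} → E v w → E (act⁻¹ v) (act⁻¹ w)

involution⇒Automorphism : ∀ {M} (g : GraphStr.V M → GraphStr.V M) → (∀ v → g (g v) ≡ v) →
                          (∀ {v w} → GraphStr.E M v w → GraphStr.E M (g v) (g w)) → Automorphism M
involution⇒Automorphism g g∘g g-E = record
  { act = g ; act⁻¹ = g ; act⁻¹∘act = g∘g ; act∘act⁻¹ = g∘g ; act-E = g-E ; act⁻¹-E = g-E }

module _ {M : GraphStr} (α : Automorphism M) where
  open GraphStr M
  open Automorphism α

  private
    act-injective : ∀ {v w} → act v ≡ act w → v ≡ w
    act-injective {v} {w} e = trans (sym (act⁻¹∘act v)) (trans (cong act⁻¹ e) (act⁻¹∘act w))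

    act-E⁻¹ : ∀ {v w} → E (act v) (act w) → E v w
    act-E⁻¹ {v} {w} e = subst₂ E (act⁻¹∘act v) (act⁻¹∘act w) (act⁻¹-E e)

    ∀-cong-act : {P Q : V → Set} → (∀ a b → b ≡ act a → P a ⇔ Q b) → (∀ a → P a) ⇔ (∀ b → Q b)
    ∀-cong-act P⇔Q = mk⇔
      (λ ∀P b → Equivalence.to (P⇔Q (act⁻¹ b) b (sym (act∘act⁻¹ b))) (∀P (act⁻¹ b)))
      (λ ∀Q a → Equivalence.from (P⇔Q a (act a) refl) (∀Q (act a)))

    extend-act : ∀ {n} {ρ ρ′ : Fin n → V} a b → (∀ x → ρ′ x ≡ act (ρ x)) → b ≡ act a →
                 ∀ x → extend b ρ′ x ≡ act (extend a ρ x)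
    extend-act a b ρ′≡ b≡ zero    = b≡
    extend-act a b ρ′≡ b≡ (suc x) = ρ′≡ x

  Sat-act : ∀ {n} (φ : Formula n) (ρ ρ′ : Fin n → V) → (∀ x → ρ′ x ≡ act (ρ x)) →
            Sat M φ ρ ⇔ Sat M φ ρ′
  Sat-act (eqF i j) ρ ρ′ ρ′≡ = ¬-cong-⇔ (¬-cong-⇔ (mk⇔
    (λ e → trans (ρ′≡ i) (trans (cong act e) (sym (ρ′≡ j))))
    (λ e → act-injective (trans (sym (ρ′≡ i)) (trans e (ρ′≡ j))))))
  Sat-act (adjF i j) ρ ρ′ ρ′≡ = ¬-cong-⇔ (¬-cong-⇔ (mk⇔
    (λ e → subst₂ E (sym (ρ′≡ i)) (sym (ρ′≡ j)) (act-E e))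
    (λ e → act-E⁻¹ (subst₂ E (ρ′≡ i) (ρ′≡ j) e))))
  Sat-act falseF     ρ ρ′ ρ′≡ = mk⇔ (λ ()) (λ ())
  Sat-act (notF φ)   ρ ρ′ ρ′≡ = ¬-cong-⇔ (Sat-act φ ρ ρ′ ρ′≡)
  Sat-act (andF φ ψ) ρ ρ′ ρ′≡ = Sat-act φ ρ ρ′ ρ′≡ ×-⇔ Sat-act ψ ρ ρ′ ρ′≡
  Sat-act (orF φ ψ)  ρ ρ′ ρ′≡ =
    ¬-cong-⇔ (¬-cong-⇔ (Sat-act φ ρ ρ′ ρ′≡) ×-⇔ ¬-cong-⇔ (Sat-act ψ ρ ρ′ ρ′≡))
  Sat-act (impF φ ψ) ρ ρ′ ρ′≡ = →-cong-⇔ (Sat-act φ ρ ρ′ ρ′≡) (Sat-act ψ ρ ρ′ ρ′≡)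
  Sat-act (exF φ)    ρ ρ′ ρ′≡ = ¬-cong-⇔ (∀-cong-act (λ a b b≡ →
    ¬-cong-⇔ (Sat-act φ (extend a ρ) (extend b ρ′) (extend-act a b ρ′≡ b≡))))
  Sat-act (allF φ)   ρ ρ′ ρ′≡ = ∀-cong-act (λ a b b≡ →
    Sat-act φ (extend a ρ) (extend b ρ′) (extend-act a b ρ′≡ b≡))

evalBC-cong : ∀ {A : Set} {v w : A → Set} → (∀ a → v a ⇔ w a) → ∀ b → evalBC v b ⇔ evalBC w b
evalBC-cong v⇔w (atom a)   = v⇔w a
evalBC-cong v⇔w (bnot b)   = ¬-cong-⇔ (evalBC-cong v⇔w b)
evalBC-cong v⇔w (band b c) = evalBC-cong v⇔w b ×-⇔ evalBC-cong v⇔w c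
evalBC-cong v⇔w (bor b c)  = ¬-cong-⇔ (¬-cong-⇔ (evalBC-cong v⇔w b) ×-⇔ ¬-cong-⇔ (evalBC-cong v⇔w c))

⋀ : ∀ {n m} → (Fin m → Formula n) → Formula n
⋀ {m = zero}  φ = notF falseF
⋀ {m = suc m} φ = andF (φ zero) (⋀ (φ ∘ suc))

Sat-⋀ : ∀ M {n m} (φ : Fin m → Formula n) ρ → Sat M (⋀ φ) ρ ⇔ (∀ i → Sat M (φ i) ρ)
Sat-⋀ M {m = zero}  φ ρ = mk⇔ (λ _ ()) (λ _ x → x)
Sat-⋀ M {m = suc m} φ ρ = mk⇔
  (λ { (s₀ , s) zero → s₀ ; (s₀ , s) (suc i) → Equivalence.to (Sat-⋀ M (φ ∘ suc) ρ) s i })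
  (λ s → s zero , Equivalence.from (Sat-⋀ M (φ ∘ suc) ρ) (s ∘ suc))

∃-∉-image : ∀ {j n} (σ : Fin j → Fin n) → j < n → ∃ λ i → ∀ x → σ x ≢ i
∃-∉-image {j} {n} σ j<n
  with ¬∀⟶∃¬ n (λ i → ∃ λ x → σ x ≡ i) (λ i → any? (λ x → σ x ≟ᶠ i)) not-onto
  where
  not-onto : ¬ (∀ i → ∃ λ x → σ x ≡ i)
  not-onto onto = <⇒≱ j<n (injective⇒≤ {f = proj₁ ∘ onto}
    (λ {a} {b} e → trans (sym (proj₂ (onto a))) (trans (cong σ e) (proj₂ (onto b)))))
... | i , i∉ = i , λ x σx≡i → i∉ (x , σx≡i)

-- Every formula in fewer than L variables misses some coordinate i, and the automorphism for i
-- makes A and B agree on it; so a Boolean combination of such formulas cannot separate A from B.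
arity-≥-by-automorphisms : ∀ M {L} (A B : Fin L → GraphStr.V M) (φ : Formula L) →
  Sat M φ A → ¬ Sat M φ B →
  (∀ i → Σ (Automorphism M) λ α → ∀ j → j ≢ i → Automorphism.act α (A j) ≡ B j) →
  ArityAtLeast M L
arity-≥-by-automorphisms M {L} A B φ A⊨φ B⊭φ swap m m<L arity≤m =
  B⊭φ (proj₂ (eqv B) (Equivalence.to (evalBC-cong small-A⇔B b) (proj₁ (eqv A) A⊨φ)))
  where
  b = proj₁ (arity≤m L φ)
  eqv = proj₂ (arity≤m L φ)
  small-A⇔B : ∀ s → satSmall M A s ⇔ satSmall M B s
  small-A⇔B (small j j≤m ψ σ) with ∃-∉-image σ (≤-<-trans j≤m m<L)
  ... | i , i∉σ = Sat-act (proj₁ (swap i)) ψ (A ∘ σ) (B ∘ σ) (λ x → sym (proj₂ (swap i) (σ x) (i∉σ x)))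

-- The hypothesis ∑-π says that π permutes [0, T).
module Relabel {k : ℕ} (π : ℕ → ℕ) (π-involutive : ∀ n → π (π n) ≡ n) (T : ℕ)
               (π-fixes-≥ : ∀ n → T ≤ n → π n ≡ n) (∑-π : ∀ f → ∑< T (f ∘ π) ≡ ∑< T f) where

  ∑-π-≥ : ∀ f N → T ≤ N → ∑< N (f ∘ π) ≡ ∑< N f
  ∑-π-≥ f N T≤N = begin
    ∑< N (f ∘ π)                                      ≡⟨ cong (λ M → ∑< M (f ∘ π)) (m∸n+n≡m T≤N) ⟨
    ∑< (N ∸ T + T) (f ∘ π)                            ≡⟨ ∑-+ (N ∸ T) T (f ∘ π) ⟩
    ∑[ t < N ∸ T ] f (π (t + T)) + ∑< T (f ∘ π)
      ≡⟨ cong₂ _+_ (∑-cong (N ∸ T) (λ t _ → cong f (π-fixes-≥ (t + T) (m≤n+m T t)))) (∑-π f) ⟩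
    ∑[ t < N ∸ T ] f (t + T) + ∑< T f                 ≡⟨ ∑-+ (N ∸ T) T f ⟨
    ∑< (N ∸ T + T) f                                  ≡⟨ cong (λ M → ∑< M f) (m∸n+n≡m T≤N) ⟩
    ∑< N f                                            ∎
    where open ≡-Reasoning

  bound+T : KSubset k → ℕ
  bound+T v = bound v + T

  size-relabel : ∀ v → ∑[ n < bound+T v ] 𝟙 (v ∋ π n) ≡ k
  size-relabel v = begin
    ∑[ n < bound+T v ] 𝟙 (v ∋ π n)  ≡⟨ ∑-π-≥ (λ n → 𝟙 (v ∋ n)) (bound+T v) (m≤n+m T (bound v)) ⟩
    ∑[ n < bound+T v ] 𝟙 (v ∋ n)    ≡⟨ size-∑ v (boundedBy-mono v (m≤m+n (bound v) T) (boundedBy-bound v)) ⟩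
    k                               ∎
    where open ≡-Reasoning

  relabel : KSubset k → KSubset k
  relabel v = fromPredicate (λ n → v ∋ π n) (bound+T v) (size-relabel v)

  ∋-relabel : ∀ v n → relabel v ∋ n ≡ v ∋ π n
  ∋-relabel v n =
    trans (∋-fromPredicate (λ n → v ∋ π n) (bound+T v) (size-relabel v) n) (by-range (n <? bound+T v))
    where
    by-range : Dec (n < bound+T v) → (n <ᵇ bound+T v) ∧ (v ∋ π n) ≡ v ∋ π n
    by-range (yes n<N) rewrite <⇒<ᵇ≡true n<N = refl
    by-range (no  n≮N)
      rewrite ≮⇒<ᵇ≡false n≮N | π-fixes-≥ n (≤-trans (m≤n+m T (bound v)) (≮⇒≥ n≮N)) =
      sym (boundedBy-∌ v n (boundedBy-bound v) (≤-trans (m≤m+n (bound v) T) (≮⇒≥ n≮N)))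

  relabel-involutive : ∀ v → relabel (relabel v) ≡ v
  relabel-involutive v = KSubset-ext (relabel (relabel v)) v (λ n →
    trans (∋-relabel (relabel v) n) (trans (∋-relabel v (π n)) (cong (v ∋_) (π-involutive n))))

  ∣∩∣-relabel : ∀ v w → ∣ relabel v ∩ relabel w ∣ ≡ ∣ v ∩ w ∣
  ∣∩∣-relabel v w = begin
    ∣ relabel v ∩ relabel w ∣
      ≡⟨ ∣∩∣-fromPredicate (λ n → v ∋ π n) (bound+T v) (size-relabel v) (relabel w) ⟩
    ∑[ n < bound+T v ] (𝟙 (v ∋ π n) * 𝟙 (relabel w ∋ n))
      ≡⟨ ∑-cong (bound+T v) (λ n _ → cong (λ b → 𝟙 (v ∋ π n) * 𝟙 b) (∋-relabel w n)) ⟩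
    ∑[ n < bound+T v ] (𝟙 (v ∋ π n) * 𝟙 (w ∋ π n))
      ≡⟨ ∑-π-≥ (λ n → 𝟙 (v ∋ n) * 𝟙 (w ∋ n)) (bound+T v) (m≤n+m T (bound v)) ⟩
    ∑[ n < bound+T v ] (𝟙 (v ∋ n) * 𝟙 (w ∋ n))
      ≡⟨ ∣∩∣-∑ v w (boundedBy-mono v (m≤m+n (bound v) T) (boundedBy-bound v)) ⟨
    ∣ v ∩ w ∣
      ∎
    where open ≡-Reasoning

  relabel-automorphism : Automorphism (Johnson k)
  relabel-automorphism =
    involution⇒Automorphism relabel relabel-involutive (λ {v} {w} v∼w → trans (∣∩∣-relabel v w) v∼w)

module JohnsonGraph (k′ : ℕ) where

  k : ℕ
  k = suc k′

  V : Set
  V = KSubset k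

  ∣∩∣-adjacent-≤ : ∀ (y z x : V) → ∣ y ∩ z ∣ ≡ k′ → ∣ z ∩ x ∣ ≤ suc ∣ y ∩ x ∣
  ∣∩∣-adjacent-≤ y z x y∼z = +-cancelʳ-≤ k′ _ _ (begin
    ∣ z ∩ x ∣ + k′          ≡⟨ cong (∣ z ∩ x ∣ +_) (trans (sym y∼z) (∣∩∣-comm y z)) ⟩
    ∣ z ∩ x ∣ + ∣ z ∩ y ∣   ≤⟨ ∣∩∣-+-∣∩∣-≤ z x y ⟩
    ∣ y ∩ x ∣ + suc k′      ≡⟨ +-suc ∣ y ∩ x ∣ k′ ⟩
    suc ∣ y ∩ x ∣ + k′      ∎)
    where open ≤-Reasoning

  exchange : ∀ (y x : V) → ∣ y ∩ x ∣ < k → ∃ λ z → ∣ y ∩ z ∣ ≡ k′ × ∣ z ∩ x ∣ ≡ suc ∣ y ∩ x ∣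
  exchange y x y∩x<k with ∃-∈-∉ y x y∩x<k | ∃-∈-∉ x y (subst (_< k) (∣∩∣-comm y x) y∩x<k)
  ... | a , y∋a , x∌a | b , x∋b , y∌b = z , y∼z , z∩x
    where
    open Replace y a b y∋a y∌b using (∣replaced∩∣) renaming (replaced to z)

    y∼z : ∣ y ∩ z ∣ ≡ k′
    y∼z = trans (∣∩∣-comm y z) (suc-injective (begin
      suc ∣ z ∩ y ∣          ≡⟨ +-comm 1 ∣ z ∩ y ∣ ⟩
      ∣ z ∩ y ∣ + 1          ≡⟨ cong (λ t → ∣ z ∩ y ∣ + 𝟙 t) y∋a ⟨
      ∣ z ∩ y ∣ + 𝟙 (y ∋ a)  ≡⟨ ∣replaced∩∣ y ⟩
      ∣ y ∩ y ∣ + 𝟙 (y ∋ b)  ≡⟨ cong₂ (λ s t → s + 𝟙 t) (∣∩∣-self y) y∌b ⟩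
      k + 0                  ≡⟨ +-identityʳ k ⟩
      k                      ∎))
      where open ≡-Reasoning

    z∩x : ∣ z ∩ x ∣ ≡ suc ∣ y ∩ x ∣
    z∩x = begin
      ∣ z ∩ x ∣              ≡⟨ +-identityʳ ∣ z ∩ x ∣ ⟨
      ∣ z ∩ x ∣ + 0          ≡⟨ cong (λ t → ∣ z ∩ x ∣ + 𝟙 t) x∌a ⟨
      ∣ z ∩ x ∣ + 𝟙 (x ∋ a)  ≡⟨ ∣replaced∩∣ x ⟩
      ∣ y ∩ x ∣ + 𝟙 (x ∋ b)  ≡⟨ cong (λ t → ∣ y ∩ x ∣ + 𝟙 t) x∋b ⟩
      ∣ y ∩ x ∣ + 1          ≡⟨ +-comm ∣ y ∩ x ∣ 1 ⟩
      suc ∣ y ∩ x ∣          ∎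
      where open ≡-Reasoning

  -- Under exF the fresh variable is zero and the old ones are shifted by suc.
  within : ∀ {n} → ℕ → Fin n → Fin n → Formula n
  within zero    a b = eqF a b
  within (suc r) a b = orF (within r a b) (exF (andF (adjF (suc a) zero) (within r zero (suc b))))

  within-sound : ∀ r {n} (a b : Fin n) (ρ : Fin n → V) → Sat (Johnson k) (within r a b) ρ →
                 k ≤ ∣ ρ a ∩ ρ b ∣ + r
  within-sound zero a b ρ s = ≮⇒≥ λ lt → s λ ρa≡ρb →
    <-irrefl (trans (cong (λ v → ∣ v ∩ ρ b ∣) ρa≡ρb) (∣∩∣-self (ρ b)))
             (≤-<-trans (≤-reflexive (sym (+-identityʳ _))) lt)
  within-sound (suc r) a b ρ s = ≮⇒≥ λ lt →
    s ((λ near → <⇒≱ (<-trans (+-monoʳ-< ∣ ρ a ∩ ρ b ∣ (n<1+n r)) lt) (within-sound r a b ρ near))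
      , (λ ∃z → ∃z (λ z (ρa∼z , near) → ρa∼z (λ ρa∼z → <⇒≱ lt (begin
          k                                 ≤⟨ within-sound r zero (suc b) (extend z ρ) near ⟩
          ∣ z ∩ ρ b ∣ + r                   ≤⟨ +-monoˡ-≤ r (∣∩∣-adjacent-≤ (ρ a) z (ρ b) ρa∼z) ⟩
          suc ∣ ρ a ∩ ρ b ∣ + r             ≡⟨ +-suc ∣ ρ a ∩ ρ b ∣ r ⟨
          ∣ ρ a ∩ ρ b ∣ + suc r             ∎)))))
    where open ≤-Reasoning

  within-complete : ∀ r {n} (a b : Fin n) (ρ : Fin n → V) → ∣ ρ a ∩ ρ b ∣ + suc r ≡ k →
                    Sat (Johnson k) (within (suc r) a b) ρ
  within-complete zero a b ρ dist≡1 (_ , ¬∃z) = ¬∃z λ ∀z →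
    ∀z (ρ b) ((λ ¬ρa∼ρb → ¬ρa∼ρb (suc-injective (trans (+-comm 1 _) dist≡1))) , (λ ¬refl → ¬refl refl))
  within-complete (suc r) a b ρ dist≡2+r (_ , ¬∃z) =
    ¬∃z (λ ∀z → ∀z z ((λ ¬ρa∼z → ¬ρa∼z ρa∼z) , within-complete r zero (suc b) (extend z ρ) dist′≡1+r))
    where
    ρa∩ρb<k : ∣ ρ a ∩ ρ b ∣ < k
    ρa∩ρb<k = subst (suc ∣ ρ a ∩ ρ b ∣ ≤_) (trans (sym (+-suc _ (suc r))) dist≡2+r) (m≤m+n _ (suc r))
    z = proj₁ (exchange (ρ a) (ρ b) ρa∩ρb<k)
    ρa∼z = proj₁ (proj₂ (exchange (ρ a) (ρ b) ρa∩ρb<k))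
    dist′≡1+r : ∣ z ∩ ρ b ∣ + suc r ≡ k
    dist′≡1+r = trans (cong (_+ suc r) (proj₂ (proj₂ (exchange (ρ a) (ρ b) ρa∩ρb<k))))
                      (trans (sym (+-suc _ (suc r))) dist≡2+r)

-- Binary strings

twice : ℕ → ℕ
twice zero    = zero
twice (suc m) = suc (suc (twice m))

data ParityView : ℕ → Set where
  even : ∀ m → ParityView (twice m)
  odd  : ∀ m → ParityView (suc (twice m))

parityView : ∀ n → ParityView n
parityView zero          = even zero
parityView (suc zero)    = odd zero
parityView (suc (suc n)) with parityView n
... | even m = even (suc m)
... | odd  m = odd (suc m)

isOdd : ℕ → Bool
isOdd zero          = false
isOdd (suc zero)    = true
isOdd (suc (suc n)) = isOdd n

isOdd-twice : ∀ m → isOdd (twice m) ≡ false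
isOdd-twice zero    = refl
isOdd-twice (suc m) = isOdd-twice m

isOdd-1+twice : ∀ m → isOdd (suc (twice m)) ≡ true
isOdd-1+twice zero    = refl
isOdd-1+twice (suc m) = isOdd-1+twice m

⌊twice/2⌋ : ∀ m → ⌊ twice m /2⌋ ≡ m
⌊twice/2⌋ zero    = refl
⌊twice/2⌋ (suc m) = cong suc (⌊twice/2⌋ m)

⌊1+twice/2⌋ : ∀ m → ⌊ suc (twice m) /2⌋ ≡ m
⌊1+twice/2⌋ zero    = refl
⌊1+twice/2⌋ (suc m) = cong suc (⌊1+twice/2⌋ m)

twice-< : ∀ {m M} → m < M → suc (twice m) < twice M
twice-< {zero}  {suc M} _         = s≤s (s≤s z≤n)
twice-< {suc m} {suc M} (s≤s m<M) = s≤s (s≤s (twice-< m<M))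

twice-<⁻¹ : ∀ {m M} → twice m < twice M → m < M
twice-<⁻¹ {zero}  {suc M} _                 = s≤s z≤n
twice-<⁻¹ {suc m} {suc M} (s≤s (s≤s 2m<2M)) = s≤s (twice-<⁻¹ 2m<2M)

2^-suc : ∀ L → 2 ^ suc L ≡ twice (2 ^ L)
2^-suc L = 2*≡twice (2 ^ L)
  where
  2*≡twice : ∀ m → 2 * m ≡ twice m
  2*≡twice zero    = refl
  2*≡twice (suc m) = cong suc (trans (+-suc m (m + 0)) (cong suc (2*≡twice m)))

∑-twice : ∀ M (f : ℕ → ℕ) → ∑< (twice M) f ≡ ∑[ m < M ] (f (twice m) + f (suc (twice m)))
∑-twice zero    f = refl
∑-twice (suc M) f = begin
  f (suc (twice M)) + (f (twice M) + ∑< (twice M) f)   ≡⟨ +-assoc (f (suc (twice M))) _ _ ⟨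
  f (suc (twice M)) + f (twice M) + ∑< (twice M) f     ≡⟨ cong₂ _+_ (+-comm (f (suc (twice M))) _) (∑-twice M f) ⟩
  f (twice M) + f (suc (twice M)) + ∑[ m < M ] (f (twice m) + f (suc (twice m))) ∎
  where open ≡-Reasoning

∑-2^-suc : ∀ L (f : ℕ → ℕ) → ∑< (2 ^ suc L) f ≡ ∑[ m < 2 ^ L ] (f (twice m) + f (suc (twice m)))
∑-2^-suc L f = trans (cong (λ N → ∑< N f) (2^-suc L)) (∑-twice (2 ^ L) f)

bit : ℕ → ℕ → Bool
bit zero    n = isOdd n
bit (suc i) n = bit i ⌊ n /2⌋

bitParity : ℕ → ℕ → Bool
bitParity zero    n = false
bitParity (suc L) n = isOdd n xor bitParity L ⌊ n /2⌋

flipBit : ℕ → ℕ → ℕ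
flipBit zero    n = if isOdd n then pred n else suc n
flipBit (suc i) n = if isOdd n then suc (twice (flipBit i ⌊ n /2⌋)) else twice (flipBit i ⌊ n /2⌋)

bit-twice : ∀ i m → bit (suc i) (twice m) ≡ bit i m
bit-twice i m = cong (bit i) (⌊twice/2⌋ m)

bit-1+twice : ∀ i m → bit (suc i) (suc (twice m)) ≡ bit i m
bit-1+twice i m = cong (bit i) (⌊1+twice/2⌋ m)

bitParity-twice : ∀ L m → bitParity (suc L) (twice m) ≡ bitParity L m
bitParity-twice L m rewrite isOdd-twice m | ⌊twice/2⌋ m = refl

bitParity-1+twice : ∀ L m → bitParity (suc L) (suc (twice m)) ≡ not (bitParity L m)
bitParity-1+twice L m rewrite isOdd-1+twice m | ⌊1+twice/2⌋ m = refl

flipBit₀-twice : ∀ m → flipBit 0 (twice m) ≡ suc (twice m)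
flipBit₀-twice m rewrite isOdd-twice m = refl

flipBit₀-1+twice : ∀ m → flipBit 0 (suc (twice m)) ≡ twice m
flipBit₀-1+twice m rewrite isOdd-1+twice m = refl

flipBit-twice : ∀ i m → flipBit (suc i) (twice m) ≡ twice (flipBit i m)
flipBit-twice i m rewrite isOdd-twice m | ⌊twice/2⌋ m = refl

flipBit-1+twice : ∀ i m → flipBit (suc i) (suc (twice m)) ≡ suc (twice (flipBit i m))
flipBit-1+twice i m rewrite isOdd-1+twice m | ⌊1+twice/2⌋ m = refl

flipBit-involutive : ∀ i n → flipBit i (flipBit i n) ≡ n
flipBit-involutive zero    n with parityView n
... | even m rewrite flipBit₀-twice m | flipBit₀-1+twice m = refl
... | odd  m rewrite flipBit₀-1+twice m | flipBit₀-twice m = refl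
flipBit-involutive (suc i) n with parityView n
... | even m rewrite flipBit-twice i m   | flipBit-twice i (flipBit i m)   | flipBit-involutive i m = refl
... | odd  m rewrite flipBit-1+twice i m | flipBit-1+twice i (flipBit i m) | flipBit-involutive i m = refl

flipBit-< : ∀ L i n → i < L → n < 2 ^ L → flipBit i n < 2 ^ L
flipBit-< (suc L) i n i<L n<2^L rewrite 2^-suc L with parityView n | i
... | even m | zero   rewrite flipBit₀-twice m      = twice-< (twice-<⁻¹ n<2^L)
... | odd  m | zero   rewrite flipBit₀-1+twice m    = <-trans (n<1+n _) n<2^L
... | even m | suc i′ rewrite flipBit-twice i′ m   =
  <-trans (n<1+n _) (twice-< (flipBit-< L i′ m (≤-pred i<L) (twice-<⁻¹ n<2^L)))
... | odd  m | suc i′ rewrite flipBit-1+twice i′ m =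
  twice-< (flipBit-< L i′ m (≤-pred i<L) (twice-<⁻¹ (<-trans (n<1+n _) n<2^L)))

bitParity-flipBit : ∀ L i n → i < L → bitParity L (flipBit i n) ≡ not (bitParity L n)
bitParity-flipBit (suc L) zero n _ with parityView n
... | even m rewrite flipBit₀-twice m   | bitParity-1+twice L m | bitParity-twice L m = refl
... | odd  m rewrite flipBit₀-1+twice m | bitParity-1+twice L m | bitParity-twice L m = sym (not-involutive _)
bitParity-flipBit (suc L) (suc i) n i<L with parityView n
... | even m rewrite flipBit-twice i m   | bitParity-twice L (flipBit i m)   | bitParity-twice L m =
  bitParity-flipBit L i m (≤-pred i<L)
... | odd  m rewrite flipBit-1+twice i m | bitParity-1+twice L (flipBit i m) | bitParity-1+twice L m =
  cong not (bitParity-flipBit L i m (≤-pred i<L))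

bit-flipBit : ∀ i j n → j ≢ i → bit j (flipBit i n) ≡ bit j n
bit-flipBit zero    zero    n j≢i = contradiction refl j≢i
bit-flipBit zero    (suc j) n _ with parityView n
... | even m rewrite flipBit₀-twice m   | bit-1+twice j m | bit-twice j m = refl
... | odd  m rewrite flipBit₀-1+twice m | bit-1+twice j m | bit-twice j m = refl
bit-flipBit (suc i) zero    n _ with parityView n
... | even m rewrite flipBit-twice i m   | isOdd-twice (flipBit i m)   | isOdd-twice m   = refl
... | odd  m rewrite flipBit-1+twice i m | isOdd-1+twice (flipBit i m) | isOdd-1+twice m = refl
bit-flipBit (suc i) (suc j) n j≢i with parityView n
... | even m rewrite flipBit-twice i m   | bit-twice j (flipBit i m)   | bit-twice j m   =
  bit-flipBit i j m (j≢i ∘ cong suc)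
... | odd  m rewrite flipBit-1+twice i m | bit-1+twice j (flipBit i m) | bit-1+twice j m =
  bit-flipBit i j m (j≢i ∘ cong suc)

∑-flipBit : ∀ L i (f : ℕ → ℕ) → i < L → ∑< (2 ^ L) (f ∘ flipBit i) ≡ ∑< (2 ^ L) f
∑-flipBit (suc L) zero f _ = begin
  ∑< (2 ^ suc L) (f ∘ flipBit 0)                                 ≡⟨ ∑-2^-suc L (f ∘ flipBit 0) ⟩
  ∑[ m < 2 ^ L ] (f (flipBit 0 (twice m)) + f (flipBit 0 (suc (twice m))))
    ≡⟨ ∑-cong (2 ^ L) (λ m _ → trans (cong₂ _+_ (cong f (flipBit₀-twice m)) (cong f (flipBit₀-1+twice m)))
                                       (+-comm (f (suc (twice m))) (f (twice m)))) ⟩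
  ∑[ m < 2 ^ L ] (f (twice m) + f (suc (twice m)))                 ≡⟨ ∑-2^-suc L f ⟨
  ∑< (2 ^ suc L) f                                                 ∎
  where open ≡-Reasoning
∑-flipBit (suc L) (suc i) f i<L = begin
  ∑< (2 ^ suc L) (f ∘ flipBit (suc i))                           ≡⟨ ∑-2^-suc L (f ∘ flipBit (suc i)) ⟩
  ∑[ m < 2 ^ L ] (f (flipBit (suc i) (twice m)) + f (flipBit (suc i) (suc (twice m))))
    ≡⟨ ∑-cong (2 ^ L) (λ m _ → cong₂ _+_ (cong f (flipBit-twice i m)) (cong f (flipBit-1+twice i m))) ⟩
  ∑< (2 ^ L) (g ∘ flipBit i)                                      ≡⟨ ∑-flipBit L i g (≤-pred i<L) ⟩
  ∑< (2 ^ L) g                                                    ≡⟨ ∑-2^-suc L f ⟨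
  ∑< (2 ^ suc L) f                                                ∎
  where
  open ≡-Reasoning
  g : ℕ → ℕ
  g m = f (twice m) + f (suc (twice m))

not-xor : ∀ a p → (not a xor p) ≡ (a xor not p)
not-xor a p = trans (sym (not-distribˡ-xor a p)) (not-distribʳ-xor a p)

𝟙-xor-not : ∀ a p → 𝟙 (a xor p) + 𝟙 (not a xor p) ≡ 1
𝟙-xor-not true  true  = refl
𝟙-xor-not true  false = refl
𝟙-xor-not false true  = refl
𝟙-xor-not false false = refl

count-bit : ∀ L i → i ≤ L → ∑[ n < 2 ^ suc L ] 𝟙 (bit i n) ≡ 2 ^ L
count-bit L zero _ = begin
  ∑[ n < 2 ^ suc L ] 𝟙 (bit 0 n)                                 ≡⟨ ∑-2^-suc L (𝟙 ∘ bit 0) ⟩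
  ∑[ m < 2 ^ L ] (𝟙 (isOdd (twice m)) + 𝟙 (isOdd (suc (twice m))))
    ≡⟨ ∑-cong (2 ^ L) (λ m _ → cong₂ _+_ (cong 𝟙 (isOdd-twice m)) (cong 𝟙 (isOdd-1+twice m))) ⟩
  ∑[ _ < 2 ^ L ] 1                                               ≡⟨ ∑-const (2 ^ L) 1 ⟩
  2 ^ L * 1                                                      ≡⟨ *-identityʳ (2 ^ L) ⟩
  2 ^ L                                                          ∎
  where open ≡-Reasoning
count-bit (suc L) (suc i) (s≤s i≤L) = begin
  ∑[ n < 2 ^ suc (suc L) ] 𝟙 (bit (suc i) n)                     ≡⟨ ∑-2^-suc (suc L) (𝟙 ∘ bit (suc i)) ⟩
  ∑[ m < 2 ^ suc L ] (𝟙 (bit (suc i) (twice m)) + 𝟙 (bit (suc i) (suc (twice m))))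
    ≡⟨ ∑-cong (2 ^ suc L) (λ m _ → trans (cong₂ _+_ (cong 𝟙 (bit-twice i m)) (cong 𝟙 (bit-1+twice i m)))
                                          (cong (𝟙 (bit i m) +_) (sym (+-identityʳ _)))) ⟩
  ∑[ m < 2 ^ suc L ] (2 * 𝟙 (bit i m))                          ≡⟨ ∑-*ˡ (2 ^ suc L) 2 (𝟙 ∘ bit i) ⟩
  2 * ∑[ m < 2 ^ suc L ] 𝟙 (bit i m)                            ≡⟨ cong (2 *_) (count-bit L i i≤L) ⟩
  2 ^ suc L                                                      ∎
  where open ≡-Reasoning

count-bitParity : ∀ L p → ∑[ n < 2 ^ suc L ] 𝟙 (bitParity (suc L) n xor p) ≡ 2 ^ L
count-bitParity L p = begin
  ∑[ n < 2 ^ suc L ] 𝟙 (bitParity (suc L) n xor p)               ≡⟨ ∑-2^-suc L (λ n → 𝟙 (bitParity (suc L) n xor p)) ⟩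
  ∑[ m < 2 ^ L ] (𝟙 (bitParity (suc L) (twice m) xor p) + 𝟙 (bitParity (suc L) (suc (twice m)) xor p))
    ≡⟨ ∑-cong (2 ^ L) (λ m _ → trans (cong₂ (λ a b → 𝟙 (a xor p) + 𝟙 (b xor p)) (bitParity-twice L m) (bitParity-1+twice L m))
                                      (𝟙-xor-not (bitParity L m) p)) ⟩
  ∑[ _ < 2 ^ L ] 1                                               ≡⟨ ∑-const (2 ^ L) 1 ⟩
  2 ^ L * 1                                                      ≡⟨ *-identityʳ (2 ^ L) ⟩
  2 ^ L                                                          ∎
  where open ≡-Reasoning

count-bit-bitParity : ∀ L i p → i ≤ suc L →
                      ∑[ n < 2 ^ suc (suc L) ] 𝟙 (bit i n ∧ (bitParity (suc (suc L)) n xor p)) ≡ 2 ^ L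
count-bit-bitParity L zero p _ = begin
  ∑[ n < 2 ^ suc (suc L) ] 𝟙 (bit 0 n ∧ (bitParity (suc (suc L)) n xor p))
    ≡⟨ ∑-2^-suc (suc L) _ ⟩
  ∑[ m < 2 ^ suc L ] (𝟙 (isOdd (twice m) ∧ (bitParity (suc (suc L)) (twice m) xor p))
                      + 𝟙 (isOdd (suc (twice m)) ∧ (bitParity (suc (suc L)) (suc (twice m)) xor p)))
    ≡⟨ ∑-cong (2 ^ suc L) (λ m _ → cong₂ _+_
         (cong (λ b → 𝟙 (b ∧ (bitParity (suc (suc L)) (twice m) xor p))) (isOdd-twice m))
         (trans (cong₂ (λ b c → 𝟙 (b ∧ (c xor p))) (isOdd-1+twice m) (bitParity-1+twice (suc L) m))
                (cong 𝟙 (not-xor (bitParity (suc L) m) p)))) ⟩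
  ∑[ m < 2 ^ suc L ] 𝟙 (bitParity (suc L) m xor not p)          ≡⟨ count-bitParity L (not p) ⟩
  2 ^ L                                                          ∎
  where open ≡-Reasoning
count-bit-bitParity L (suc i) p (s≤s i≤L) = begin
  ∑[ n < 2 ^ suc (suc L) ] 𝟙 (bit (suc i) n ∧ (bitParity (suc (suc L)) n xor p))
    ≡⟨ ∑-2^-suc (suc L) _ ⟩
  ∑[ m < 2 ^ suc L ] (𝟙 (bit (suc i) (twice m) ∧ (bitParity (suc (suc L)) (twice m) xor p))
                      + 𝟙 (bit (suc i) (suc (twice m)) ∧ (bitParity (suc (suc L)) (suc (twice m)) xor p)))
    ≡⟨ ∑-cong (2 ^ suc L) (λ m _ → trans
         (cong₂ _+_ (cong₂ (λ b c → 𝟙 (b ∧ (c xor p))) (bit-twice i m) (bitParity-twice (suc L) m))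
                    (cong₂ (λ b c → 𝟙 (b ∧ (c xor p))) (bit-1+twice i m) (bitParity-1+twice (suc L) m)))
         (𝟙-∧-split (bit i m) (bitParity (suc L) m))) ⟩
  ∑[ m < 2 ^ suc L ] 𝟙 (bit i m)                                ≡⟨ count-bit L i i≤L ⟩
  2 ^ L                                                          ∎
  where
  open ≡-Reasoning
  𝟙-∧-split : ∀ b a → 𝟙 (b ∧ (a xor p)) + 𝟙 (b ∧ (not a xor p)) ≡ 𝟙 b
  𝟙-∧-split false a = refl
  𝟙-∧-split true  a = 𝟙-xor-not a p

ones : ℕ → ℕ
ones zero    = 0
ones (suc L) = suc (twice (ones L))

1+ones : ∀ L → suc (ones L) ≡ 2 ^ L
1+ones zero    = refl
1+ones (suc L) = trans (cong twice (1+ones L)) (sym (2^-suc L))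

bit-ones : ∀ L i → i < L → bit i (ones L) ≡ true
bit-ones (suc L) zero    _   = isOdd-1+twice (ones L)
bit-ones (suc L) (suc i) i<L = trans (bit-1+twice i (ones L)) (bit-ones L i (≤-pred i<L))

bitParity-all-set : ∀ L n → (∀ i → i < L → bit i n ≡ true) → bitParity L n ≡ bitParity L (ones L)
bitParity-all-set zero    n _   = refl
bitParity-all-set (suc L) n set rewrite set 0 (s≤s z≤n) | isOdd-1+twice (ones L) | ⌊1+twice/2⌋ (ones L) =
  cong not (bitParity-all-set L ⌊ n /2⌋ (λ i i<L → set (suc i) (s≤s i<L)))

all-set-or-unset : ∀ L n → (∀ i → i < L → bit i n ≡ true) ⊎ ∃ λ i → i < L × bit i n ≡ false
all-set-or-unset zero    n = inj₁ (λ _ ())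
all-set-or-unset (suc L) n with isOdd n in odd? | all-set-or-unset L ⌊ n /2⌋
... | false | _                     = inj₂ (0 , s≤s z≤n , odd?)
... | true  | inj₁ set              = inj₁ λ { zero _ → odd? ; (suc i) i<L → set i (≤-pred i<L) }
... | true  | inj₂ (i , i<L , unset) = inj₂ (suc i , s≤s i<L , unset)

-- The construction

module Construction (q : ℕ) where

  p u L : ℕ
  p = suc q
  u = ones p
  L = suc (suc p)

  open JohnsonGraph (L * u) public

  T N : ℕ
  T = 2 ^ L
  N = u * L + T

  T≤N : T ≤ N
  T≤N = m≤n+m T (u * L)

  ones<T : ones L < T
  ones<T = subst (ones L <_) (1+ones L) ≤-refl

  ∑-N : ∀ f → ∑< N f ≡ ∑[ t < u * L ] f (t + T) + ∑< T f
  ∑-N = ∑-+ (u * L) T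

  1+u+u*[1+p]≡k : suc u + u * suc p ≡ k
  1+u+u*[1+p]≡k = cong suc (cong (u +_) (*-comm u (suc p)))

  splitAtT : {X : Set} → (ℕ → X) → (ℕ → X) → ℕ → X
  splitAtT low high n = if n <ᵇ T then low n else high n

  splitAtT-< : ∀ {X : Set} (low high : ℕ → X) n → n < T → splitAtT low high n ≡ low n
  splitAtT-< low high n n<T rewrite <⇒<ᵇ≡true n<T = refl

  splitAtT-≥ : ∀ {X : Set} (low high : ℕ → X) n → T ≤ n → splitAtT low high n ≡ high n
  splitAtT-≥ low high n T≤n rewrite ≮⇒<ᵇ≡false (≤⇒≯ T≤n) = refl

  parityA parityB : Bool
  parityB = bitParity L (ones L)
  parityA = not parityB

  member : Bool → ℕ → ℕ → Bool
  member par i = splitAtT (λ n → bit i n ∧ (bitParity L n xor par)) (λ n → not ((n ∸ T) % L ≡ᵇ i))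

  member-low : ∀ par i n → n < T → member par i n ≡ bit i n ∧ (bitParity L n xor par)
  member-low par i = splitAtT-< _ _

  member-high : ∀ par i n → T ≤ n → member par i n ≡ not ((n ∸ T) % L ≡ᵇ i)
  member-high par i = splitAtT-≥ _ _

  member-+T : ∀ par i t → member par i (t + T) ≡ not (t % L ≡ᵇ i)
  member-+T par i t =
    trans (member-high par i (t + T) (m≤n+m T t)) (cong (λ n → not (n % L ≡ᵇ i)) (m+n∸n≡m t T))

  count-≢ : ∀ i → i < L → ∑[ n < L ] 𝟙 (not (n ≡ᵇ i)) ≡ suc p
  count-≢ i i<L = +-cancelʳ-≡ 1 _ _ (begin
    ∑[ n < L ] 𝟙 (not (n ≡ᵇ i)) + 1
      ≡⟨ cong (∑[ n < L ] 𝟙 (not (n ≡ᵇ i)) +_) (∑-delta i L (λ _ → 1) i<L) ⟨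
    ∑[ n < L ] 𝟙 (not (n ≡ᵇ i)) + ∑[ n < L ] (𝟙 (n ≡ᵇ i) * 1)
      ≡⟨ ∑-distrib-+ L (λ n → 𝟙 (not (n ≡ᵇ i))) _ ⟨
    ∑[ n < L ] (𝟙 (not (n ≡ᵇ i)) + 𝟙 (n ≡ᵇ i) * 1)
      ≡⟨ ∑-cong L (λ n _ → 𝟙-not (n ≡ᵇ i)) ⟩
    ∑[ _ < L ] 1
      ≡⟨ trans (∑-const L 1) (*-identityʳ L) ⟩
    L
      ≡⟨ +-comm 1 (suc p) ⟩
    suc p + 1
      ∎)
    where
    open ≡-Reasoning
    𝟙-not : ∀ b → 𝟙 (not b) + 𝟙 b * 1 ≡ 1
    𝟙-not true  = refl
    𝟙-not false = refl

  count-high : ∀ i → i < L → ∑[ t < u * L ] 𝟙 (not (t % L ≡ᵇ i)) ≡ u * suc p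
  count-high i i<L = trans (∑-mod L u (λ n → 𝟙 (not (n ≡ᵇ i)))) (cong (u *_) (count-≢ i i<L))

  size-member : ∀ par i → i < L → ∑[ n < N ] 𝟙 (member par i n) ≡ k
  size-member par i i<L = begin
    ∑[ n < N ] 𝟙 (member par i n)
      ≡⟨ ∑-N _ ⟩
    ∑[ t < u * L ] 𝟙 (member par i (t + T)) + ∑[ n < T ] 𝟙 (member par i n)
      ≡⟨ cong₂ _+_ (∑-cong (u * L) (λ t _ → cong 𝟙 (member-+T par i t)))
                   (∑-cong T (λ n n<T → cong 𝟙 (member-low par i n n<T))) ⟩
    ∑[ t < u * L ] 𝟙 (not (t % L ≡ᵇ i)) + ∑[ n < T ] 𝟙 (bit i n ∧ (bitParity L n xor par))
      ≡⟨ cong₂ _+_ (count-high i i<L) (trans (count-bit-bitParity p i par (≤-pred i<L)) (sym (1+ones p))) ⟩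
    u * suc p + suc u
      ≡⟨ +-comm (u * suc p) (suc u) ⟩
    suc u + u * suc p
      ≡⟨ 1+u+u*[1+p]≡k ⟩
    k
      ∎
    where open ≡-Reasoning

  vertex : Bool → Fin L → V
  vertex par i = fromPredicate (member par (toℕ i)) N (size-member par (toℕ i) (toℕ<n i))

  ∋-vertex : ∀ par i n → vertex par i ∋ n ≡ (n <ᵇ N) ∧ member par (toℕ i) n
  ∋-vertex par i = ∋-fromPredicate (member par (toℕ i)) N (size-member par (toℕ i) (toℕ<n i))

  ∋-vertex-< : ∀ par i n → n < N → vertex par i ∋ n ≡ member par (toℕ i) n
  ∋-vertex-< par i n n<N = trans (∋-vertex par i n) (cong (_∧ member par (toℕ i) n) (<⇒<ᵇ≡true n<N))

  A B : Fin L → V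
  A = vertex parityA
  B = vertex parityB

  centreMember : ℕ → Bool
  centreMember = splitAtT (_≡ᵇ ones L) (λ _ → true)

  centreMember-low : ∀ n → n < T → centreMember n ≡ (n ≡ᵇ ones L)
  centreMember-low = splitAtT-< (_≡ᵇ ones L) (λ _ → true)

  centreMember-+T : ∀ t → centreMember (t + T) ≡ true
  centreMember-+T t = splitAtT-≥ (_≡ᵇ ones L) (λ _ → true) (t + T) (m≤n+m T t)

  size-centre : ∑[ n < N ] 𝟙 (centreMember n) ≡ k
  size-centre = begin
    ∑[ n < N ] 𝟙 (centreMember n)
      ≡⟨ ∑-N _ ⟩
    ∑[ t < u * L ] 𝟙 (centreMember (t + T)) + ∑[ n < T ] 𝟙 (centreMember n)
      ≡⟨ cong₂ _+_ (∑-cong (u * L) (λ t _ → cong 𝟙 (centreMember-+T t)))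
                   (∑-cong T (λ n n<T → trans (cong 𝟙 (centreMember-low n n<T)) (sym (*-identityʳ _)))) ⟩
    ∑[ _ < u * L ] 1 + ∑[ n < T ] (𝟙 (n ≡ᵇ ones L) * 1)
      ≡⟨ cong₂ _+_ (trans (∑-const (u * L) 1) (*-identityʳ _)) (∑-delta (ones L) T (λ _ → 1) ones<T) ⟩
    u * L + 1
      ≡⟨ +-comm (u * L) 1 ⟩
    suc (u * L)
      ≡⟨ cong suc (*-comm u L) ⟩
    k
      ∎
    where open ≡-Reasoning

  centre : V
  centre = fromPredicate centreMember N size-centre

  ones∈A : ∀ i → i < L → member parityA i (ones L) ≡ true
  ones∈A i i<L rewrite member-low parityA i (ones L) ones<T | bit-ones L i i<L = xor-inverseʳ parityB

  ∣centre∩A∣+u : ∀ i → ∣ centre ∩ A i ∣ + u ≡ k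
  ∣centre∩A∣+u i = begin
    ∣ centre ∩ A i ∣ + u
      ≡⟨ cong (_+ u) (trans (∣∩∣-fromPredicate² centreMember (member parityA j) N size-centre (size-member parityA j j<L))
                            (∑-N _)) ⟩
    ∑[ t < u * L ] (𝟙 (centreMember (t + T)) * 𝟙 (member parityA j (t + T)))
      + ∑[ n < T ] (𝟙 (centreMember n) * 𝟙 (member parityA j n)) + u
      ≡⟨ cong (_+ u) (cong₂ _+_ (∑-cong (u * L) (λ t _ → high t)) (∑-cong T low)) ⟩
    ∑[ t < u * L ] 𝟙 (not (t % L ≡ᵇ j)) + ∑[ n < T ] (𝟙 (n ≡ᵇ ones L) * 𝟙 (member parityA j n)) + u
      ≡⟨ cong (_+ u) (cong₂ _+_ (count-high j j<L)
                                (trans (∑-delta (ones L) T (𝟙 ∘ member parityA j) ones<T) (cong 𝟙 (ones∈A j j<L)))) ⟩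
    u * suc p + 1 + u
      ≡⟨ trans (+-assoc (u * suc p) 1 u) (+-comm (u * suc p) (suc u)) ⟩
    suc u + u * suc p
      ≡⟨ 1+u+u*[1+p]≡k ⟩
    k
      ∎
    where
    open ≡-Reasoning
    j = toℕ i
    j<L = toℕ<n i
    high : ∀ t → 𝟙 (centreMember (t + T)) * 𝟙 (member parityA j (t + T)) ≡ 𝟙 (not (t % L ≡ᵇ j))
    high t = trans (cong₂ (λ b c → 𝟙 b * 𝟙 c) (centreMember-+T t) (member-+T parityA j t)) (*-identityˡ _)
    low : ∀ n → n < T → 𝟙 (centreMember n) * 𝟙 (member parityA j n) ≡ 𝟙 (n ≡ᵇ ones L) * 𝟙 (member parityA j n)
    low n n<T = cong (λ b → 𝟙 b * 𝟙 (member parityA j n)) (centreMember-low n n<T)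

  member-B-unmatched : ∀ n → ∃ λ (j : Fin L) → member parityB (toℕ j) n ≡ false
  member-B-unmatched n with n <? T
  ... | no n≮T = fromℕ< j<L , trans (member-high parityB _ n (≮⇒≥ n≮T))
                                   (cong not (≡⇒≡ᵇ≡true (sym (toℕ-fromℕ< j<L))))
    where j<L = m%n<n (n ∸ T) L
  ... | yes n<T with all-set-or-unset L n
  ...   | inj₂ (i , i<L , unset) = fromℕ< i<L , (begin
          member parityB (toℕ (fromℕ< i<L)) n                     ≡⟨ member-low parityB _ n n<T ⟩
          bit (toℕ (fromℕ< i<L)) n ∧ (bitParity L n xor parityB)  ≡⟨ cong (λ j → bit j n ∧ _) (toℕ-fromℕ< i<L) ⟩
          bit i n ∧ (bitParity L n xor parityB)                   ≡⟨ cong (_∧ _) unset ⟩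
          false                                                   ∎)
    where open ≡-Reasoning
  ...   | inj₁ all-set = zero , (begin
          member parityB 0 n                      ≡⟨ member-low parityB 0 n n<T ⟩
          bit 0 n ∧ (bitParity L n xor parityB)   ≡⟨ cong₂ (λ b c → b ∧ (c xor parityB)) (all-set 0 (s≤s z≤n))
                                                           (bitParity-all-set L n all-set) ⟩
          parityB xor parityB                     ≡⟨ xor-same parityB ⟩
          false                                   ∎)
    where open ≡-Reasoning

  B-uncovered : ∀ n → ∃ λ j → B j ∋ n ≡ false
  B-uncovered n with member-B-unmatched n
  ... | j , unmatched = j , trans (∋-vertex parityB j n) (trans (cong ((n <ᵇ N) ∧_) unmatched) (∧-zeroʳ _))

  member-flipBit : ∀ i j n → i < L → j ≢ i → n < T → member parityA j (flipBit i n) ≡ member parityB j n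
  member-flipBit i j n i<L j≢i n<T = begin
    member parityA j (flipBit i n)
      ≡⟨ member-low parityA j (flipBit i n) (flipBit-< L i n i<L n<T) ⟩
    bit j (flipBit i n) ∧ (bitParity L (flipBit i n) xor parityA)
      ≡⟨ cong₂ (λ b c → b ∧ (c xor parityA)) (bit-flipBit i j n j≢i) (bitParity-flipBit L i n i<L) ⟩
    bit j n ∧ (not (bitParity L n) xor not parityB)
      ≡⟨ cong (bit j n ∧_) (trans (not-xor (bitParity L n) parityA) (cong (bitParity L n xor_) (not-involutive parityB))) ⟩
    bit j n ∧ (bitParity L n xor parityB)
      ≡⟨ member-low parityB j n n<T ⟨
    member parityB j n
      ∎
    where open ≡-Reasoning

  module Swap (i : Fin L) where

    flipᵢ : ℕ → ℕ
    flipᵢ = flipBit (toℕ i)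

    flipᵢ-<T : ∀ n → n < T → flipᵢ n < T
    flipᵢ-<T n = flipBit-< L (toℕ i) n (toℕ<n i)

    π : ℕ → ℕ
    π = splitAtT flipᵢ id

    π-involutive : ∀ n → π (π n) ≡ n
    π-involutive n with n <? T
    ... | yes n<T rewrite splitAtT-< flipᵢ id n n<T | splitAtT-< flipᵢ id (flipᵢ n) (flipᵢ-<T n n<T) =
      flipBit-involutive (toℕ i) n
    ... | no  n≮T rewrite splitAtT-≥ flipᵢ id n (≮⇒≥ n≮T) = splitAtT-≥ flipᵢ id n (≮⇒≥ n≮T)

    ∑-π : ∀ f → ∑< T (f ∘ π) ≡ ∑< T f
    ∑-π f = trans (∑-cong T (λ n n<T → cong f (splitAtT-< flipᵢ id n n<T))) (∑-flipBit L (toℕ i) f (toℕ<n i))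

    open Relabel {k} π π-involutive T (splitAtT-≥ flipᵢ id) ∑-π

    A∋π : ∀ j → j ≢ i → ∀ n → A j ∋ π n ≡ B j ∋ n
    A∋π j j≢i n with n <? T
    ... | yes n<T = begin
      A j ∋ π n                           ≡⟨ cong (A j ∋_) (splitAtT-< flipᵢ id n n<T) ⟩
      A j ∋ flipᵢ n                       ≡⟨ ∋-vertex-< parityA j (flipᵢ n) (≤-trans (flipᵢ-<T n n<T) T≤N) ⟩
      member parityA (toℕ j) (flipᵢ n)    ≡⟨ member-flipBit (toℕ i) (toℕ j) n (toℕ<n i) (j≢i ∘ toℕ-injective) n<T ⟩
      member parityB (toℕ j) n            ≡⟨ ∋-vertex-< parityB j n (≤-trans n<T T≤N) ⟨
      B j ∋ n                             ∎
      where open ≡-Reasoning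
    ... | no  n≮T = begin
      A j ∋ π n                            ≡⟨ cong (A j ∋_) (splitAtT-≥ flipᵢ id n T≤n) ⟩
      A j ∋ n                              ≡⟨ ∋-vertex parityA j n ⟩
      (n <ᵇ N) ∧ member parityA (toℕ j) n  ≡⟨ cong ((n <ᵇ N) ∧_) (trans (member-high parityA _ n T≤n)
                                                                       (sym (member-high parityB _ n T≤n))) ⟩
      (n <ᵇ N) ∧ member parityB (toℕ j) n  ≡⟨ ∋-vertex parityB j n ⟨
      B j ∋ n                              ∎
      where
      open ≡-Reasoning
      T≤n = ≮⇒≥ n≮T

    swap : Σ (Automorphism (Johnson k)) λ α → ∀ j → j ≢ i → Automorphism.act α (A j) ≡ B j
    swap = relabel-automorphism , λ j j≢i →
      KSubset-ext (relabel (A j)) (B j) (λ n → trans (∋-relabel (A j) n) (A∋π j j≢i n))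

  near : Fin L → Formula (suc L)
  near i = within u zero (suc i)

  ∃-near-all : Formula L
  ∃-near-all = exF (⋀ near)

  A⊨∃-near-all : Sat (Johnson k) ∃-near-all A
  A⊨∃-near-all ∀y¬near = ∀y¬near centre (Equivalence.from (Sat-⋀ (Johnson k) near (extend centre A))
    (λ i → within-complete (twice (ones q)) zero (suc i) (extend centre A) (∣centre∩A∣+u i)))

  B⊭∃-near-all : ¬ Sat (Johnson k) ∃-near-all B
  B⊭∃-near-all B⊨ = B⊨ λ y y-near → no-vertex-near-all u B B-uncovered ≤-refl y λ j →
    within-sound u zero (suc j) (extend y B) (Equivalence.to (Sat-⋀ (Johnson k) near (extend y B)) y-near j)

  arity-≥-L : ArityAtLeast (Johnson k) L
  arity-≥-L = arity-≥-by-automorphisms (Johnson k) A B ∃-near-all A⊨∃-near-all B⊭∃-near-all Swap.swap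

proposition3p18 : (l : ℕ) → 1 ≤ l → Σ ℕ λ k → 1 ≤ k × ArityAtLeast (Johnson k) l
proposition3p18 l _ = k , s≤s z≤n , λ m m<l → arity-≥-L m (<-trans m<l (m<n+m l (s≤s z≤n)))
  where open Construction l
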